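{- For each $r\in\{3, 14, 36, 47, 58, 69, 80, 91, 102, 113\}$ and every nonnegative integer $k$, $$ \mathrm{cp}_{3,1,4}(121k+r) \equiv 0 \pmod 2.$$
   Context: For integers $a,b,m\ge1$, an $(a,b,m)$-copartition is a triple of integer partitions $(\gamma,\rho,\sigma)$ such that every part of $\gamma$ is $\ge a$ and $\equiv a \pmod m$, every part of $\sigma$ is $\ge b$ and $\equiv b\pmod m$, and $\rho$ has exactly as many parts as $\sigma$, each part of $\rho$ being equal to $m$ times the number of parts of $\gamma$. Its size is the sum of all parts of $\gamma,\rho,\sigma$, and $\mathrm{cp}_{a,b,m}(n)$ denotes the number of $(a,b,m)$-copartitions of size $n$. -}

module Defs where

open import Data.Nat using (ℕ; zero; suc; _+_; _*_; _∸_; _≤_; _≤?_; _⊓_)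
open import Data.Nat.Properties using (_≟_)
open import Data.Nat.Divisibility using (_∣_; _∣?_)
open import Data.List using (List; []; _∷_; map; concatMap; length; filter; sum; upTo; replicate)
open import Data.List.Relation.Unary.All using (All; all?)
open import Data.Product using (_×_; _,_)
open import Relation.Binary.PropositionalEquality using (_≡_)
open import Relation.Nullary.Decidable using (Dec; _×-dec_)

-- An integer partition is a non-increasing list of positive integers.
Partition : Set
Partition = List ℕ

-- Partitions with size n and all parts ≤ k, using fuel f (f ≥ n suffices,
-- since each part is ≥ 1).  Parts are listed in non-increasing order.
boundedPartitions : (f n k : ℕ) → List Partition
boundedPartitions zero    zero    k = [] ∷ []
boundedPartitions zero    (suc n) k = []
boundedPartitions (suc f) zero    k = [] ∷ []
boundedPartitions (suc f) (suc n) k =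
  concatMap (λ i → let p = suc i in map (p ∷_) (boundedPartitions f (suc n ∸ p) p))
            (upTo (k ⊓ suc n))

partitions : ℕ → List Partition
partitions n = boundedPartitions n n n

-- Candidate triples (γ , ρ , σ): γ and σ range over all partitions of size ≤ n,
-- and ρ is the (forced) list of length |σ|-many copies of m·(#parts of γ).
-- Note: ρ may consist of zeros when γ is empty.
candidates : ℕ → ℕ → List (Partition × Partition × Partition)
candidates m n =
  concatMap (λ i →
    concatMap (λ l →
      concatMap (λ γ →
        map (λ σ → (γ , replicate (length σ) (m * length γ) , σ)) (partitions l))
      (partitions i))
    (upTo (suc n)))
  (upTo (suc n))

size : Partition × Partition × Partition → ℕ
size (γ , ρ , σ) = sum γ + sum ρ + sum σ

Admissible : ℕ → ℕ → ℕ → Set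
Admissible a m x = (a ≤ x) × (m ∣ (x ∸ a))

admissible? : (a m x : ℕ) → Dec (Admissible a m x)
admissible? a m x = (a ≤? x) ×-dec (m ∣? (x ∸ a))

IsCopartition : ℕ → ℕ → ℕ → Partition × Partition × Partition → Set
IsCopartition a b m (γ , ρ , σ) =
  All (Admissible a m) γ ×
  All (Admissible b m) σ ×
  (length ρ ≡ length σ) ×
  All (λ x → x ≡ m * length γ) ρ

isCopartition? : (a b m : ℕ) → (t : Partition × Partition × Partition) → Dec (IsCopartition a b m t)
isCopartition? a b m (γ , ρ , σ) =
  all? (admissible? a m) γ ×-dec
  (all? (admissible? b m) σ ×-dec
  ((length ρ ≟ length σ) ×-dec
  all? (λ x → x ≟ m * length γ) ρ))

cp : ℕ → ℕ → ℕ → ℕ → ℕ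
cp a b m n = length (filter (λ t → isCopartition? a b m t ×-dec (size t ≟ n)) (candidates m n))

{-# OPTIONS --safe #-}
-- Over 𝔽₂, the generating series of cp_{3,1,4} is Σ_j q^(3j)/(q⁴;q⁴)_j · 1/(q^(1+4j);q⁴)_∞.
-- Euler's identity and the q-binomial theorem turn it into (q⁴;q⁴)_∞ / ((q;q⁴)_∞ (q³;q⁴)_∞),
-- which is (q;q)_∞ (q⁴;q⁴)_∞ since (q;q²)_∞ (q;q)_∞ = 1 mod 2. By Euler's pentagonal theorem,
-- cp(n) is then odd only if n = e₁ + 4e₂ with e₁, e₂ generalized pentagonal numbers. As
-- 24e + 1 is a square x² for such e, this gives 24n + 5 = x₁² + 4x₂². Since -4 is not a square
-- modulo 11, 11 ∣ x₁² + 4x₂² forces 121 ∣ x₁² + 4x₂², which fails for n = 121k + r when 11 divides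
-- 24r + 5 exactly once. Series are handled coefficientwise, and the infinite identities as
-- congruences modulo a large power of q.
module Submission where

open import Algebra.Bundles using (CommutativeRing)
open import Data.Bool using (Bool; true; false; _xor_; _∧_; not)
open import Data.Bool.Properties
  using (xor-assoc; xor-comm; xor-same; xor-identityʳ; ∧-zeroʳ; ∧-identityʳ; ∧-comm; ∧-assoc;
         ∧-distribˡ-xor; ∧-distribʳ-xor; xor-∧-commutativeRing; not-involutive)
open import Data.Nat using (ℕ; zero; suc; _+_; _*_; _∸_; _≤_; _<_; z≤n; s≤s; _≤?_; _≡ᵇ_; _≟_; _⊓_; z<s; _%_)
open import Data.Nat.Properties
open import Data.Nat.Tactic.RingSolver using (solve-∀)
open import Data.Sum using (inj₁; inj₂)
open import Data.List using (List; []; _∷_; _++_; map; concatMap; length; filter; applyUpTo; upTo; replicate)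
open import Data.List.Properties using (length-replicate)
open import Data.List.Membership.Propositional using (_∈_)
open import Data.List.Relation.Unary.All as All using (All; []; _∷_; all?)
open import Data.List.Relation.Unary.All.Properties using (concat⁺; map⁺; applyUpTo⁺₁; replicate⁺)
open import Data.Nat.ListAction using (sum)
open import Data.Nat.Divisibility
  using (_∣_; _∤_; _∣?_; divides; ∣-trans; *-pres-∣; ∣m∣n⇒∣m+n; ∣m+n∣m⇒∣n; n∣m*n; m%n≡0⇒n∣m; n∣m⇒m%n≡0)
open import Data.Nat.DivMod using (%-distribˡ-+; %-distribˡ-*; m%n<n)
open import Data.Fin using (Fin; toℕ; fromℕ<)
open import Data.Fin.Properties using (toℕ-fromℕ<)
import Data.Fin.Properties as Fin
open import Data.Product using (_×_; _,_; proj₁; proj₂; ∃)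
open import Defs
open import Relation.Binary.PropositionalEquality using (_≡_; _≢_; refl; sym; trans; cong; cong₂; subst; _≗_; module ≡-Reasoning)
open import Relation.Nullary using (Dec; yes; no; does; _×-dec_)
open import Relation.Nullary.Decidable using (dec-true; dec-false; from-yes; _→-dec_; ¬?)
open import Relation.Nullary.Negation using (contradiction)
open import Algebra.Properties.CommutativeSemigroup
  (CommutativeRing.+-commutativeSemigroup xor-∧-commutativeRing)
  using () renaming (interchange to xor-interchange)
open import Algebra.Properties.Group (CommutativeRing.+-group xor-∧-commutativeRing)
  using () renaming (∙-cancelʳ to xor-cancelʳ)

xor-cancelˡ-inverse : ∀ a b → a xor (a xor b) ≡ b
xor-cancelˡ-inverse a b = trans (sym (xor-assoc a a b)) (cong (_xor b) (xor-same a))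

xor-cancelʳ-inverse : ∀ a b → (a xor b) xor b ≡ a
xor-cancelʳ-inverse a b = trans (xor-assoc a b b) (trans (cong (a xor_) (xor-same b)) (xor-identityʳ a))

xor-cancel-middle : ∀ a b c → (a xor b) xor (b xor c) ≡ a xor c
xor-cancel-middle a b c = trans (xor-assoc a b (b xor c)) (cong (a xor_) (xor-cancelˡ-inverse b c))

Series : Set
Series = ℕ → Bool

infixl 6 _⊕_
_⊕_ : Series → Series → Series
(f ⊕ g) m = f m xor g m

𝟘 𝟙 : Series
𝟘 _ = false
𝟙 zero = true
𝟙 (suc _) = false

infixr 7 q^_·_
q^_·_ : ℕ → Series → Series
q^ zero · f = f
(q^ suc e · f) zero = false
(q^ suc e · f) (suc m) = (q^ e · f) m

infixr 7 ⟨1+q^_⟩_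
⟨1+q^_⟩_ : ℕ → Series → Series
⟨1+q^ e ⟩ f = f ⊕ q^ e · f

-- f ≈[ N ] g is the congruence f ≡ g (mod q^N).
infix 4 _≈[_]_
_≈[_]_ : Series → ℕ → Series → Set
f ≈[ N ] g = ∀ m → m < N → f m ≡ g m

≗⇒≈ : ∀ {f g} N → f ≗ g → f ≈[ N ] g
≗⇒≈ N f≗g m _ = f≗g m

≈-sym : ∀ {f g N} → f ≈[ N ] g → g ≈[ N ] f
≈-sym f≈g m m<N = sym (f≈g m m<N)

≈-trans : ∀ {f g h N} → f ≈[ N ] g → g ≈[ N ] h → f ≈[ N ] h
≈-trans f≈g g≈h m m<N = trans (f≈g m m<N) (g≈h m m<N)

≈-mono : ∀ {f g N N′} → N′ ≤ N → f ≈[ N ] g → f ≈[ N′ ] g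
≈-mono N′≤N f≈g m m<N′ = f≈g m (<-≤-trans m<N′ N′≤N)

≈-extend : ∀ {f g N} → f ≈[ N ] g → f N ≡ g N → f ≈[ suc N ] g
≈-extend {N = N} f≈g eq m m<1+N with m≤n⇒m<n∨m≡n (≤-pred m<1+N)
... | inj₁ m<N = f≈g m m<N
... | inj₂ refl = eq

⊕-cong : ∀ {f f′ g g′} → f ≗ f′ → g ≗ g′ → f ⊕ g ≗ f′ ⊕ g′
⊕-cong f≗f′ g≗g′ m = cong₂ _xor_ (f≗f′ m) (g≗g′ m)

⊕-cong≈ : ∀ {f f′ g g′ N} → f ≈[ N ] f′ → g ≈[ N ] g′ → f ⊕ g ≈[ N ] f′ ⊕ g′
⊕-cong≈ f≈f′ g≈g′ m m<N = cong₂ _xor_ (f≈f′ m m<N) (g≈g′ m m<N)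

⊕-interchange : ∀ f g h k → (f ⊕ g) ⊕ (h ⊕ k) ≗ (f ⊕ h) ⊕ (g ⊕ k)
⊕-interchange f g h k m = xor-interchange (f m) (g m) (h m) (k m)

⊕-solve : ∀ {f g h N} → f ⊕ g ≈[ N ] h → g ≈[ N ] f ⊕ h
⊕-solve {f} {g} eq m m<N = trans (sym (xor-cancelˡ-inverse (f m) (g m))) (cong (f m xor_) (eq m m<N))

⊕-swap : ∀ {f g h k N} → f ⊕ g ≈[ N ] h ⊕ k → f ⊕ h ≈[ N ] g ⊕ k
⊕-swap {f} {g} {h} {k} eq m m<N = sym (trans (⊕-solve {f ⊕ h} cancels m m<N) (xor-identityʳ _))
  where
  cancels : (f ⊕ h) ⊕ (g ⊕ k) ≈[ _ ] 𝟘
  cancels m m<N = trans (⊕-interchange f h g k m) (trans (cong ((f ⊕ g) m xor_) (sym (eq m m<N))) (xor-same ((f ⊕ g) m)))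

q^·-below : ∀ e f m → m < e → (q^ e · f) m ≡ false
q^·-below (suc e) f zero _ = refl
q^·-below (suc e) f (suc m) (s≤s m<e) = q^·-below e f m m<e

q^·-at : ∀ e f m → (q^ e · f) (e + m) ≡ f m
q^·-at zero f m = refl
q^·-at (suc e) f m = q^·-at e f m

q^·-above : ∀ e f m → e ≤ m → (q^ e · f) m ≡ f (m ∸ e)
q^·-above e f m e≤m = trans (cong (q^ e · f) (sym (m+[n∸m]≡n e≤m))) (q^·-at e f (m ∸ e))

q^·-cong : ∀ e {f g} → f ≗ g → q^ e · f ≗ q^ e · g
q^·-cong zero f≗g m = f≗g m
q^·-cong (suc e) f≗g zero = refl
q^·-cong (suc e) f≗g (suc m) = q^·-cong e f≗g m

q^·-cong≈+ : ∀ e {f g N} → f ≈[ N ] g → q^ e · f ≈[ e + N ] q^ e · g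
q^·-cong≈+ zero f≈g m m<N = f≈g m m<N
q^·-cong≈+ (suc e) f≈g zero _ = refl
q^·-cong≈+ (suc e) f≈g (suc m) (s≤s m<e+N) = q^·-cong≈+ e f≈g m m<e+N

q^·-cong≈ : ∀ e {f g N} → f ≈[ N ] g → q^ e · f ≈[ N ] q^ e · g
q^·-cong≈ e {N = N} f≈g = ≈-mono (m≤n+m N e) (q^·-cong≈+ e f≈g)

q^-exponent : ∀ {e e′} f → e ≡ e′ → q^ e · f ≗ q^ e′ · f
q^-exponent f refl m = refl

q^·-⊕ : ∀ e f g → q^ e · (f ⊕ g) ≗ q^ e · f ⊕ q^ e · g
q^·-⊕ zero f g m = refl
q^·-⊕ (suc e) f g zero = refl
q^·-⊕ (suc e) f g (suc m) = q^·-⊕ e f g m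

q^·-q^· : ∀ a b f → q^ a · q^ b · f ≗ q^ (a + b) · f
q^·-q^· zero b f m = refl
q^·-q^· (suc a) b f zero = refl
q^·-q^· (suc a) b f (suc m) = q^·-q^· a b f m

q^·-comm : ∀ a b f → q^ a · q^ b · f ≗ q^ b · q^ a · f
q^·-comm a b f m = begin
  (q^ a · q^ b · f) m  ≡⟨ q^·-q^· a b f m ⟩
  (q^ (a + b) · f) m   ≡⟨ q^-exponent f (+-comm a b) m ⟩
  (q^ (b + a) · f) m   ≡⟨ q^·-q^· b a f m ⟨
  (q^ b · q^ a · f) m  ∎
  where open ≡-Reasoning

q^·-𝟘 : ∀ e → q^ e · 𝟘 ≗ 𝟘
q^·-𝟘 zero m = refl
q^·-𝟘 (suc e) zero = refl
q^·-𝟘 (suc e) (suc m) = q^·-𝟘 e m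

q^·≈𝟘 : ∀ e f {N} → N ≤ e → q^ e · f ≈[ N ] 𝟘
q^·≈𝟘 e f N≤e m m<N = q^·-below e f m (<-≤-trans m<N N≤e)

q^·-preserves-≈𝟘 : ∀ e {f N} → f ≈[ N ] 𝟘 → q^ e · f ≈[ N ] 𝟘
q^·-preserves-≈𝟘 e f≈𝟘 = ≈-trans (q^·-cong≈ e f≈𝟘) (≗⇒≈ _ (q^·-𝟘 e))

1+q^-cong : ∀ e {f g} → f ≗ g → ⟨1+q^ e ⟩ f ≗ ⟨1+q^ e ⟩ g
1+q^-cong e f≗g = ⊕-cong f≗g (q^·-cong e f≗g)

1+q^-cong≈ : ∀ e {f g N} → f ≈[ N ] g → ⟨1+q^ e ⟩ f ≈[ N ] ⟨1+q^ e ⟩ g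
1+q^-cong≈ e f≈g = ⊕-cong≈ f≈g (q^·-cong≈ e f≈g)

1+q^-exponent : ∀ {e e′} f → e ≡ e′ → ⟨1+q^ e ⟩ f ≗ ⟨1+q^ e′ ⟩ f
1+q^-exponent f refl m = refl

1+q^-q^· : ∀ e a f → ⟨1+q^ e ⟩ q^ a · f ≗ q^ a · ⟨1+q^ e ⟩ f
1+q^-q^· e a f m = trans (cong ((q^ a · f) m xor_) (q^·-comm e a f m)) (sym (q^·-⊕ a f (q^ e · f) m))

1+q^-comm : ∀ a b f → ⟨1+q^ a ⟩ ⟨1+q^ b ⟩ f ≗ ⟨1+q^ b ⟩ ⟨1+q^ a ⟩ f
1+q^-comm a b f m = begin
  (⟨1+q^ a ⟩ ⟨1+q^ b ⟩ f) m                            ≡⟨ cong ((f ⊕ q^ b · f) m xor_) (q^·-⊕ a f (q^ b · f) m) ⟩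
  (f ⊕ q^ b · f) m xor (q^ a · f ⊕ q^ a · q^ b · f) m  ≡⟨ cong (λ x → (f ⊕ q^ b · f) m xor ((q^ a · f) m xor x)) (q^·-comm a b f m) ⟩
  (f ⊕ q^ b · f) m xor (q^ a · f ⊕ q^ b · q^ a · f) m  ≡⟨ ⊕-interchange f (q^ b · f) (q^ a · f) (q^ b · q^ a · f) m ⟩
  (f ⊕ q^ a · f) m xor (q^ b · f ⊕ q^ b · q^ a · f) m  ≡⟨ cong ((f ⊕ q^ a · f) m xor_) (q^·-⊕ b f (q^ a · f) m) ⟨
  (⟨1+q^ b ⟩ ⟨1+q^ a ⟩ f) m                            ∎
  where open ≡-Reasoning

1+q^≈id : ∀ e f {N} → N ≤ e → ⟨1+q^ e ⟩ f ≈[ N ] f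
1+q^≈id e f N≤e m m<N = trans (cong (f m xor_) (q^·≈𝟘 e f N≤e m m<N)) (xor-identityʳ (f m))

1+q^-square : ∀ e f → ⟨1+q^ e ⟩ ⟨1+q^ e ⟩ f ≗ ⟨1+q^ (e + e) ⟩ f
1+q^-square e f m = begin
  (⟨1+q^ e ⟩ ⟨1+q^ e ⟩ f) m                              ≡⟨ cong ((f ⊕ q^ e · f) m xor_) (q^·-⊕ e f (q^ e · f) m) ⟩
  (f m xor (q^ e · f) m) xor ((q^ e · f) m xor (q^ e · q^ e · f) m) ≡⟨ xor-cancel-middle (f m) _ _ ⟩
  f m xor (q^ e · q^ e · f) m                            ≡⟨ cong (f m xor_) (q^·-q^· e e f m) ⟩
  (⟨1+q^ (e + e) ⟩ f) m                                  ∎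
  where open ≡-Reasoning

-- Coefficient N of (1 + q^(e+1)) f is f N plus a coefficient of f of index below N.
1+q^-injective : ∀ e {f g} N → ⟨1+q^ suc e ⟩ f ≈[ N ] ⟨1+q^ suc e ⟩ g → f ≈[ N ] g
1+q^-injective e zero _ m ()
1+q^-injective e {f} {g} (suc N) eq = ≈-extend below (xor-cancelʳ _ (f N) (g N) (trans (eq N ≤-refl) (cong (g N xor_) (sym shifted))))
  where
  below : f ≈[ N ] g
  below = 1+q^-injective e N (≈-mono (n≤1+n N) eq)
  shifted : (q^ suc e · f) N ≡ (q^ suc e · g) N
  shifted = q^·-cong≈+ (suc e) below N (s≤s (m≤n+m N e))

⨁ : ℕ → (ℕ → Series) → Series
⨁ zero F = 𝟘
⨁ (suc n) F = ⨁ n F ⊕ F n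

⨁-cong : ∀ n {F G} → (∀ k → k < n → F k ≗ G k) → ⨁ n F ≗ ⨁ n G
⨁-cong zero F≗G m = refl
⨁-cong (suc n) F≗G m = cong₂ _xor_ (⨁-cong n (λ k k<n → F≗G k (m<n⇒m<1+n k<n)) m) (F≗G n ≤-refl m)

⨁-cong≈ : ∀ n {F G N} → (∀ k → k < n → F k ≈[ N ] G k) → ⨁ n F ≈[ N ] ⨁ n G
⨁-cong≈ zero F≈G m _ = refl
⨁-cong≈ (suc n) F≈G m m<N =
  cong₂ _xor_ (⨁-cong≈ n (λ k k<n → F≈G k (m<n⇒m<1+n k<n)) m m<N) (F≈G n ≤-refl m m<N)

⨁-≈𝟘 : ∀ n F {N} → (∀ k → k < n → F k ≈[ N ] 𝟘) → ⨁ n F ≈[ N ] 𝟘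
⨁-≈𝟘 zero F F≈𝟘 m _ = refl
⨁-≈𝟘 (suc n) F F≈𝟘 m m<N =
  cong₂ _xor_ (⨁-≈𝟘 n F (λ k k<n → F≈𝟘 k (m<n⇒m<1+n k<n)) m m<N) (F≈𝟘 n ≤-refl m m<N)

⨁-⊕ : ∀ n F G → ⨁ n (λ k → F k ⊕ G k) ≗ ⨁ n F ⊕ ⨁ n G
⨁-⊕ zero F G m = refl
⨁-⊕ (suc n) F G m = trans (cong (_xor (F n ⊕ G n) m) (⨁-⊕ n F G m)) (⊕-interchange (⨁ n F) (⨁ n G) (F n) (G n) m)

q^·-⨁ : ∀ e n F → q^ e · ⨁ n F ≗ ⨁ n (λ k → q^ e · F k)
q^·-⨁ e zero F m = q^·-𝟘 e m
q^·-⨁ e (suc n) F m = trans (q^·-⊕ e (⨁ n F) (F n) m) (cong (_xor (q^ e · F n) m) (q^·-⨁ e n F m))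

⨁-suc : ∀ n F → ⨁ (suc n) F ≗ F 0 ⊕ ⨁ n (λ k → F (suc k))
⨁-suc zero F m = xor-comm false (F 0 m)
⨁-suc (suc n) F m = trans (cong (_xor F (suc n) m) (⨁-suc n F m)) (xor-assoc (F 0 m) _ _)

⨁-drop-last : ∀ n F {N} → F n ≈[ N ] 𝟘 → ⨁ (suc n) F ≈[ N ] ⨁ n F
⨁-drop-last n F Fn≈𝟘 m m<N = trans (cong (⨁ n F m xor_) (Fn≈𝟘 m m<N)) (xor-identityʳ _)

infixr 7 ∏⟨1+q^_⟩_
∏⟨1+q^_⟩_ : List ℕ → Series → Series
∏⟨1+q^ [] ⟩ f = f
∏⟨1+q^ e ∷ es ⟩ f = ⟨1+q^ e ⟩ ∏⟨1+q^ es ⟩ f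

∏-cong : ∀ es {f g} → f ≗ g → ∏⟨1+q^ es ⟩ f ≗ ∏⟨1+q^ es ⟩ g
∏-cong [] f≗g = f≗g
∏-cong (e ∷ es) f≗g = 1+q^-cong e (∏-cong es f≗g)

∏-cong≈ : ∀ es {f g N} → f ≈[ N ] g → ∏⟨1+q^ es ⟩ f ≈[ N ] ∏⟨1+q^ es ⟩ g
∏-cong≈ [] f≈g = f≈g
∏-cong≈ (e ∷ es) f≈g = 1+q^-cong≈ e (∏-cong≈ es f≈g)

∏-1+q^ : ∀ es e f → ∏⟨1+q^ es ⟩ ⟨1+q^ e ⟩ f ≗ ⟨1+q^ e ⟩ ∏⟨1+q^ es ⟩ f
∏-1+q^ [] e f m = refl
∏-1+q^ (e′ ∷ es) e f m = trans (1+q^-cong e′ (∏-1+q^ es e f) m) (1+q^-comm e′ e (∏⟨1+q^ es ⟩ f) m)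

∏-q^· : ∀ es e f → ∏⟨1+q^ es ⟩ q^ e · f ≗ q^ e · ∏⟨1+q^ es ⟩ f
∏-q^· [] e f m = refl
∏-q^· (e′ ∷ es) e f m = trans (1+q^-cong e′ (∏-q^· es e f) m) (1+q^-q^· e′ e (∏⟨1+q^ es ⟩ f) m)

∏-++ : ∀ es es′ f → ∏⟨1+q^ es ++ es′ ⟩ f ≗ ∏⟨1+q^ es ⟩ ∏⟨1+q^ es′ ⟩ f
∏-++ [] es′ f m = refl
∏-++ (e ∷ es) es′ f m = 1+q^-cong e (∏-++ es es′ f) m

∏-comm : ∀ es es′ f → ∏⟨1+q^ es ⟩ ∏⟨1+q^ es′ ⟩ f ≗ ∏⟨1+q^ es′ ⟩ ∏⟨1+q^ es ⟩ f
∏-comm es [] f m = refl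
∏-comm es (e ∷ es′) f m = trans (∏-1+q^ es e (∏⟨1+q^ es′ ⟩ f) m) (1+q^-cong e (∏-comm es es′ f) m)

∏≈id : ∀ es f {N} → All (N ≤_) es → ∏⟨1+q^ es ⟩ f ≈[ N ] f
∏≈id [] f [] = λ _ _ → refl
∏≈id (e ∷ es) f (N≤e ∷ N≤es) = ≈-trans (1+q^≈id e (∏⟨1+q^ es ⟩ f) N≤e) (∏≈id es f N≤es)

∏-injective : ∀ es {f g N} → All (1 ≤_) es → ∏⟨1+q^ es ⟩ f ≈[ N ] ∏⟨1+q^ es ⟩ g → f ≈[ N ] g
∏-injective [] [] eq = eq
∏-injective (suc e ∷ es) (_ ∷ 1≤es) eq = ∏-injective es 1≤es (1+q^-injective e _ eq)

∏-preserves-≈𝟘 : ∀ es {f N} → f ≈[ N ] 𝟘 → ∏⟨1+q^ es ⟩ f ≈[ N ] 𝟘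
∏-preserves-≈𝟘 [] f≈𝟘 = f≈𝟘
∏-preserves-≈𝟘 (e ∷ es) f≈𝟘 m m<N = trans (1+q^-cong≈ e (∏-preserves-≈𝟘 es f≈𝟘) m m<N) (cong (false xor_) (q^·-𝟘 e m))

multiples : ℕ → ℕ → List ℕ
multiples t zero = []
multiples t (suc n) = t * suc n ∷ multiples t n

oneTo : ℕ → List ℕ
oneTo zero = []
oneTo (suc n) = suc n ∷ oneTo n

interval : ℕ → ℕ → List ℕ
interval n zero = []
interval n (suc k) = suc (k + n) ∷ interval n k

odds : ℕ → List ℕ
odds zero = []
odds (suc n) = suc (n + n) ∷ odds n

multiples-1 : ∀ n → multiples 1 n ≡ oneTo n
multiples-1 zero = refl
multiples-1 (suc n) = cong₂ _∷_ (*-identityˡ (suc n)) (multiples-1 n)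

oneTo-+ : ∀ k n → oneTo (k + n) ≡ interval n k ++ oneTo n
oneTo-+ zero n = refl
oneTo-+ (suc k) n = cong (suc (k + n) ∷_) (oneTo-+ k n)

oneTo-positive : ∀ n → All (1 ≤_) (oneTo n)
oneTo-positive zero = []
oneTo-positive (suc n) = s≤s z≤n ∷ oneTo-positive n

interval-above : ∀ n k → All (suc n ≤_) (interval n k)
interval-above n zero = []
interval-above n (suc k) = s≤s (m≤n+m n k) ∷ interval-above n k

-- (q;q)ₙ² (q;q²)ₙ = (q²;q²)ₙ (q;q²)ₙ = (q;q)₂ₙ over 𝔽₂.
∏-oneTo-square-odds : ∀ n f → ∏⟨1+q^ oneTo n ⟩ ∏⟨1+q^ oneTo n ⟩ ∏⟨1+q^ odds n ⟩ f ≗ ∏⟨1+q^ oneTo (n + n) ⟩ f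
∏-oneTo-square-odds zero f m = refl
∏-oneTo-square-odds (suc n) f m = begin
  (⟨1+q^ a ⟩ Q (⟨1+q^ a ⟩ Q (⟨1+q^ o ⟩ O f))) m  ≡⟨ 1+q^-cong a (∏-1+q^ (oneTo n) a (Q (⟨1+q^ o ⟩ O f))) m ⟩
  (⟨1+q^ a ⟩ ⟨1+q^ a ⟩ Q (Q (⟨1+q^ o ⟩ O f))) m  ≡⟨ 1+q^-square a (Q (Q (⟨1+q^ o ⟩ O f))) m ⟩
  (⟨1+q^ (a + a) ⟩ Q (Q (⟨1+q^ o ⟩ O f))) m      ≡⟨ 1+q^-cong (a + a) (λ m′ → trans (∏-cong (oneTo n) (∏-1+q^ (oneTo n) o (O f)) m′)
                                                                             (∏-1+q^ (oneTo n) o (Q (O f)) m′)) m ⟩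
  (⟨1+q^ (a + a) ⟩ ⟨1+q^ o ⟩ Q (Q (O f))) m      ≡⟨ 1+q^-cong (a + a) (1+q^-cong o (∏-oneTo-square-odds n f)) m ⟩
  (⟨1+q^ (a + a) ⟩ ⟨1+q^ o ⟩ Q₂ₙ f) m            ≡⟨ 1+q^-exponent (⟨1+q^ o ⟩ Q₂ₙ f) (cong suc (+-suc n n)) m ⟩
  (∏⟨1+q^ oneTo (suc (suc (n + n))) ⟩ f) m       ≡⟨ cong (λ k → (∏⟨1+q^ oneTo k ⟩ f) m) (+-suc (suc n) n) ⟨
  (∏⟨1+q^ oneTo (suc n + suc n) ⟩ f) m           ∎
  where
  open ≡-Reasoning
  a = suc n
  o = suc (n + n)
  Q = ∏⟨1+q^ oneTo n ⟩_
  O = ∏⟨1+q^ odds n ⟩_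
  Q₂ₙ = ∏⟨1+q^ oneTo (n + n) ⟩_

∏-oneTo-odds≈id : ∀ n f → ∏⟨1+q^ oneTo n ⟩ ∏⟨1+q^ odds n ⟩ f ≈[ suc n ] f
∏-oneTo-odds≈id n f = ≈-trans cancelled (∏≈id (interval n n) f (interval-above n n))
  where
  Q = ∏⟨1+q^ oneTo n ⟩_
  split : Q (Q (∏⟨1+q^ odds n ⟩ f)) ≗ Q (∏⟨1+q^ interval n n ⟩ f)
  split m = begin
    Q (Q (∏⟨1+q^ odds n ⟩ f)) m                    ≡⟨ ∏-oneTo-square-odds n f m ⟩
    (∏⟨1+q^ oneTo (n + n) ⟩ f) m                   ≡⟨ cong (λ es → (∏⟨1+q^ es ⟩ f) m) (oneTo-+ n n) ⟩
    (∏⟨1+q^ interval n n ++ oneTo n ⟩ f) m         ≡⟨ ∏-++ (interval n n) (oneTo n) f m ⟩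
    (∏⟨1+q^ interval n n ⟩ Q f) m                  ≡⟨ ∏-comm (interval n n) (oneTo n) f m ⟩
    Q (∏⟨1+q^ interval n n ⟩ f) m                  ∎
    where open ≡-Reasoning
  cancelled : Q (∏⟨1+q^ odds n ⟩ f) ≈[ suc n ] ∏⟨1+q^ interval n n ⟩ f
  cancelled = ∏-injective (oneTo n) (oneTo-positive n) (≗⇒≈ (suc n) split)

multiplesAbove : ℕ → ℕ → ℕ → List ℕ
multiplesAbove t k zero = []
multiplesAbove t k (suc n) with k ≤? n
... | yes _ = t * suc n ∷ multiplesAbove t k n
... | no _ = []

multiplesAbove-suc : ∀ t k n → k ≤ n → multiplesAbove t k (suc n) ≡ t * suc n ∷ multiplesAbove t k n
multiplesAbove-suc t k n k≤n with k ≤? n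
... | yes _ = refl
... | no k≰n = contradiction k≤n k≰n

multiplesAbove-empty : ∀ t k n → n ≤ k → multiplesAbove t k n ≡ []
multiplesAbove-empty t k zero _ = refl
multiplesAbove-empty t k (suc n) n<k with k ≤? n
... | yes k≤n = contradiction (≤-trans n<k k≤n) 1+n≰n
... | no _ = refl

multiplesAbove-0 : ∀ t n → multiplesAbove t 0 n ≡ multiples t n
multiplesAbove-0 t zero = refl
multiplesAbove-0 t (suc n) = trans (multiplesAbove-suc t 0 n z≤n) (cong (t * suc n ∷_) (multiplesAbove-0 t n))

∏-multiplesAbove-pred : ∀ t k n f → suc k ≤ n →
  ⟨1+q^ t * suc k ⟩ ∏⟨1+q^ multiplesAbove t (suc k) n ⟩ f ≗ ∏⟨1+q^ multiplesAbove t k n ⟩ f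
∏-multiplesAbove-pred t k (suc n) f (s≤s k≤n) m with m≤n⇒m<n∨m≡n k≤n
... | inj₁ k<n = begin
  (⟨1+q^ t * suc k ⟩ ∏⟨1+q^ multiplesAbove t (suc k) (suc n) ⟩ f) m
    ≡⟨ cong (λ es → (⟨1+q^ t * suc k ⟩ ∏⟨1+q^ es ⟩ f) m) (multiplesAbove-suc t (suc k) n k<n) ⟩
  (⟨1+q^ t * suc k ⟩ ⟨1+q^ t * suc n ⟩ ∏⟨1+q^ multiplesAbove t (suc k) n ⟩ f) m
    ≡⟨ 1+q^-comm (t * suc k) (t * suc n) (∏⟨1+q^ multiplesAbove t (suc k) n ⟩ f) m ⟩
  (⟨1+q^ t * suc n ⟩ ⟨1+q^ t * suc k ⟩ ∏⟨1+q^ multiplesAbove t (suc k) n ⟩ f) m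
    ≡⟨ 1+q^-cong (t * suc n) (∏-multiplesAbove-pred t k n f k<n) m ⟩
  (⟨1+q^ t * suc n ⟩ ∏⟨1+q^ multiplesAbove t k n ⟩ f) m
    ≡⟨ cong (λ es → (∏⟨1+q^ es ⟩ f) m) (multiplesAbove-suc t k n k≤n) ⟨
  (∏⟨1+q^ multiplesAbove t k (suc n) ⟩ f) m ∎
  where open ≡-Reasoning
... | inj₂ refl = begin
  (⟨1+q^ t * suc k ⟩ ∏⟨1+q^ multiplesAbove t (suc k) (suc k) ⟩ f) m
    ≡⟨ cong (λ es → (⟨1+q^ t * suc k ⟩ ∏⟨1+q^ es ⟩ f) m) (multiplesAbove-empty t (suc k) (suc k) ≤-refl) ⟩
  (⟨1+q^ t * suc k ⟩ f) m
    ≡⟨ cong (λ es → (⟨1+q^ t * suc k ⟩ ∏⟨1+q^ es ⟩ f) m) (multiplesAbove-empty t k k ≤-refl) ⟨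
  (⟨1+q^ t * suc k ⟩ ∏⟨1+q^ multiplesAbove t k k ⟩ f) m
    ≡⟨ cong (λ es → (∏⟨1+q^ es ⟩ f) m) (multiplesAbove-suc t k k ≤-refl) ⟨
  (∏⟨1+q^ multiplesAbove t k (suc k) ⟩ f) m ∎
  where open ≡-Reasoning

triangular : ℕ → ℕ
triangular zero = 0
triangular (suc k) = triangular k + suc k

shanksExponent : ℕ → ℕ → ℕ
shanksExponent n k = n * k + triangular k

shanksExponent-0 : ∀ n → shanksExponent n 0 ≡ 0
shanksExponent-0 n = trans (+-identityʳ (n * 0)) (*-zeroʳ n)

-- Shanks' proof of Euler's pentagonal theorem: the terms
--   q^(t(nk + k(k+1)/2)) ∏_{k<i≤n} (1 + q^(ti))
-- sum over k ≤ n to the pentagonal sum and, for k = 0, give ∏_{i≤n} (1 + q^(ti)).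
shanksTerm : ℕ → ℕ → ℕ → Series → Series
shanksTerm t n k f = q^ t * shanksExponent n k · ∏⟨1+q^ multiplesAbove t k n ⟩ f

shanksTerm-suc : ∀ t n k f → k ≤ n →
  shanksTerm t (suc n) k f ≗ q^ t * k · ⟨1+q^ t * suc n ⟩ shanksTerm t n k f
shanksTerm-suc t n k f k≤n m = begin
  (q^ t * shanksExponent (suc n) k · ∏⟨1+q^ multiplesAbove t k (suc n) ⟩ f) m
    ≡⟨ cong (λ es → (q^ t * shanksExponent (suc n) k · ∏⟨1+q^ es ⟩ f) m) (multiplesAbove-suc t k n k≤n) ⟩
  (q^ t * shanksExponent (suc n) k · ⟨1+q^ t * suc n ⟩ P) m
    ≡⟨ q^-exponent (⟨1+q^ t * suc n ⟩ P) exponent m ⟩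
  (q^ (t * k + t * shanksExponent n k) · ⟨1+q^ t * suc n ⟩ P) m
    ≡⟨ q^·-q^· (t * k) (t * shanksExponent n k) (⟨1+q^ t * suc n ⟩ P) m ⟨
  (q^ t * k · q^ t * shanksExponent n k · ⟨1+q^ t * suc n ⟩ P) m
    ≡⟨ q^·-cong (t * k) (λ m′ → sym (1+q^-q^· (t * suc n) (t * shanksExponent n k) P m′)) m ⟩
  (q^ t * k · ⟨1+q^ t * suc n ⟩ shanksTerm t n k f) m ∎
  where
  open ≡-Reasoning
  P = ∏⟨1+q^ multiplesAbove t k n ⟩ f
  exponent : t * shanksExponent (suc n) k ≡ t * k + t * shanksExponent n k
  exponent = trans (cong (t *_) (+-assoc k (n * k) (triangular k))) (*-distribˡ-+ t k (shanksExponent n k))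

1+q^-shanksTerm : ∀ t n k f → suc k ≤ n →
  ⟨1+q^ t * suc k ⟩ shanksTerm t n (suc k) f ≗ q^ t * (n + suc k) · shanksTerm t n k f
1+q^-shanksTerm t n k f k<n m = begin
  (⟨1+q^ t * suc k ⟩ q^ t * shanksExponent n (suc k) · ∏⟨1+q^ multiplesAbove t (suc k) n ⟩ f) m
    ≡⟨ 1+q^-q^· (t * suc k) (t * shanksExponent n (suc k)) _ m ⟩
  (q^ t * shanksExponent n (suc k) · ⟨1+q^ t * suc k ⟩ ∏⟨1+q^ multiplesAbove t (suc k) n ⟩ f) m
    ≡⟨ q^·-cong (t * shanksExponent n (suc k)) (∏-multiplesAbove-pred t k n f k<n) m ⟩
  (q^ t * shanksExponent n (suc k) · P) m
    ≡⟨ q^-exponent P exponent m ⟩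
  (q^ (t * (n + suc k) + t * shanksExponent n k) · P) m
    ≡⟨ q^·-q^· (t * (n + suc k)) (t * shanksExponent n k) P m ⟨
  (q^ t * (n + suc k) · shanksTerm t n k f) m ∎
  where
  open ≡-Reasoning
  P = ∏⟨1+q^ multiplesAbove t k n ⟩ f
  exponent : t * shanksExponent n (suc k) ≡ t * (n + suc k) + t * shanksExponent n k
  exponent = begin
    t * (n * suc k + (triangular k + suc k))          ≡⟨ cong (λ x → t * (x + (triangular k + suc k))) (*-suc n k) ⟩
    t * (n + n * k + (triangular k + suc k))          ≡⟨ cong (t *_) (regroup n k (triangular k)) ⟩
    t * ((n + suc k) + (n * k + triangular k))        ≡⟨ *-distribˡ-+ t (n + suc k) (shanksExponent n k) ⟩
    t * (n + suc k) + t * shanksExponent n k          ∎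
    where
    regroup : ∀ n k x → n + n * k + (x + suc k) ≡ (n + suc k) + (n * k + x)
    regroup = solve-∀

-- The generalized pentagonal numbers ω(j+1) and ω(-(j+1)), where ω(k) = k(3k-1)/2.
ω⁺ ω⁻ : ℕ → ℕ
ω⁺ j = suc (j + j) + shanksExponent j j
ω⁻ j = shanksExponent (suc j) (suc j)

shanksSum : ℕ → ℕ → Series → Series
shanksSum t n f = ⨁ (suc n) (λ k → shanksTerm t n k f)

pentagonalSum : ℕ → ℕ → Series → Series
pentagonalSum t n f = f ⊕ ⨁ n (λ j → q^ t * ω⁺ j · f ⊕ q^ t * ω⁻ j · f)

shanksSum-suc-split : ∀ t n f → ⨁ (suc n) (λ k → shanksTerm t (suc n) k f)
  ≗ ⨁ (suc n) (λ k → q^ t * k · shanksTerm t n k f) ⊕ ⨁ (suc n) (λ k → q^ t * (n + suc k) · shanksTerm t n k f)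
shanksSum-suc-split t n f m =
  trans (⨁-cong (suc n) (λ k k<1+n m′ → trans (shanksTerm-suc t n k f (≤-pred k<1+n) m′)
          (trans (q^·-⊕ (t * k) (X k) (q^ t * suc n · X k) m′)
                 (cong ((q^ t * k · X k) m′ xor_) (trans (q^·-q^· (t * k) (t * suc n) (X k) m′) (q^-exponent (X k) (exponent k) m′))))) m)
        (⨁-⊕ (suc n) (λ k → q^ t * k · X k) (λ k → q^ t * (n + suc k) · X k) m)
  where
  X : ℕ → Series
  X k = shanksTerm t n k f
  exponent : ∀ k → t * k + t * suc n ≡ t * (n + suc k)
  exponent k = trans (sym (*-distribˡ-+ t k (suc n))) (cong (t *_) (trans (+-comm k (suc n)) (sym (+-suc n k))))

-- The k = 0 term cancels and the others telescope by 1+q^-shanksTerm.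
shanksSum-telescope : ∀ t n f → shanksSum t n f ⊕ ⨁ (suc n) (λ k → q^ t * k · shanksTerm t n k f)
  ≗ ⨁ n (λ k → q^ t * (n + suc k) · shanksTerm t n k f)
shanksSum-telescope t n f m = begin
  (shanksSum t n f ⊕ ⨁ (suc n) (λ k → q^ t * k · X k)) m  ≡⟨ ⨁-⊕ (suc n) X (λ k → q^ t * k · X k) m ⟨
  ⨁ (suc n) (λ k → ⟨1+q^ t * k ⟩ X k) m                   ≡⟨ ⨁-suc n (λ k → ⟨1+q^ t * k ⟩ X k) m ⟩
  (⟨1+q^ t * 0 ⟩ X 0) m xor ⨁ n (λ k → ⟨1+q^ t * suc k ⟩ X (suc k)) m
    ≡⟨ cong₂ _xor_ (trans (1+q^-exponent (X 0) (*-zeroʳ t) m) (xor-same (X 0 m)))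
                   (⨁-cong n (λ k k<n → 1+q^-shanksTerm t n k f k<n) m) ⟩
  ⨁ n (λ k → q^ t * (n + suc k) · X k) m                  ∎
  where
  open ≡-Reasoning
  X : ℕ → Series
  X k = shanksTerm t n k f

shanksTerm-diagonal : ∀ t n f → q^ t * (n + suc n) · shanksTerm t n n f ≗ q^ t * ω⁺ n · f
shanksTerm-diagonal t n f m =
  trans (q^·-cong (t * (n + suc n)) (q^·-cong (t * shanksExponent n n)
          (λ m′ → cong (λ es → (∏⟨1+q^ es ⟩ f) m′) (multiplesAbove-empty t n n ≤-refl))) m)
        (trans (q^·-q^· (t * (n + suc n)) (t * shanksExponent n n) f m) (q^-exponent f exponent m))
  where
  exponent : t * (n + suc n) + t * shanksExponent n n ≡ t * ω⁺ n
  exponent = trans (sym (*-distribˡ-+ t (n + suc n) (shanksExponent n n))) (cong (λ x → t * (x + shanksExponent n n)) (+-suc n n))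

shanksTerm-last : ∀ t n f → shanksTerm t (suc n) (suc n) f ≗ q^ t * ω⁻ n · f
shanksTerm-last t n f = q^·-cong (t * ω⁻ n) (λ m → cong (λ es → (∏⟨1+q^ es ⟩ f) m) (multiplesAbove-empty t (suc n) (suc n) ≤-refl))

shanksSum-suc : ∀ t n f → shanksSum t (suc n) f ≗ shanksSum t n f ⊕ (q^ t * ω⁺ n · f ⊕ q^ t * ω⁻ n · f)
shanksSum-suc t n f m = begin
  shanksSum t (suc n) f m
    ≡⟨ cong (_xor shanksTerm t (suc n) (suc n) f m) (shanksSum-suc-split t n f m) ⟩
  (S₁ m xor (R m xor (q^ t * (n + suc n) · shanksTerm t n n f) m)) xor shanksTerm t (suc n) (suc n) f m
    ≡⟨ cong₂ (λ x y → (S₁ m xor (x xor y)) xor shanksTerm t (suc n) (suc n) f m)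
             (shanksSum-telescope t n f m) (sym (shanksTerm-diagonal t n f m)) ⟨
  (S₁ m xor ((S m xor S₁ m) xor Z m)) xor shanksTerm t (suc n) (suc n) f m
    ≡⟨ cong₂ _xor_ (xor-cancel-outer (S₁ m) (S m) (Z m)) (shanksTerm-last t n f m) ⟩
  (S m xor Z m) xor (q^ t * ω⁻ n · f) m
    ≡⟨ xor-assoc (S m) (Z m) _ ⟩
  S m xor (Z m xor (q^ t * ω⁻ n · f) m) ∎
  where
  open ≡-Reasoning
  S = shanksSum t n f
  S₁ = ⨁ (suc n) (λ k → q^ t * k · shanksTerm t n k f)
  R = ⨁ n (λ k → q^ t * (n + suc k) · shanksTerm t n k f)
  Z = q^ t * ω⁺ n · f
  xor-cancel-outer : ∀ a b c → a xor ((b xor a) xor c) ≡ b xor c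
  xor-cancel-outer a b c = begin
    a xor ((b xor a) xor c)  ≡⟨ cong (λ x → a xor (x xor c)) (xor-comm b a) ⟩
    a xor ((a xor b) xor c)  ≡⟨ cong (a xor_) (xor-assoc a b c) ⟩
    a xor (a xor (b xor c))  ≡⟨ xor-cancelˡ-inverse a (b xor c) ⟩
    b xor c                  ∎

shanksSum≗pentagonalSum : ∀ t n f → shanksSum t n f ≗ pentagonalSum t n f
shanksSum≗pentagonalSum t zero f m = trans (q^-exponent f (*-zeroʳ t) m) (sym (xor-identityʳ (f m)))
shanksSum≗pentagonalSum t (suc n) f m = begin
  shanksSum t (suc n) f m                                      ≡⟨ shanksSum-suc t n f m ⟩
  shanksSum t n f m xor new m                                  ≡⟨ cong (_xor new m) (shanksSum≗pentagonalSum t n f m) ⟩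
  (f m xor ⨁ n pentagonalTerms m) xor new m                    ≡⟨ xor-assoc (f m) _ (new m) ⟩
  pentagonalSum t (suc n) f m                                  ∎
  where
  open ≡-Reasoning
  pentagonalTerms : ℕ → Series
  pentagonalTerms j = q^ t * ω⁺ j · f ⊕ q^ t * ω⁻ j · f
  new = pentagonalTerms n

shanksTerm-suc≈𝟘 : ∀ t n k f → shanksTerm t n (suc k) f ≈[ t * suc n ] 𝟘
shanksTerm-suc≈𝟘 t n k f = q^·≈𝟘 (t * shanksExponent n (suc k)) _ (*-monoʳ-≤ t 1+n≤exponent)
  where
  1+n≤exponent : suc n ≤ n * suc k + (triangular k + suc k)
  1+n≤exponent = subst (_≤ n * suc k + (triangular k + suc k)) (+-comm n 1)
                   (+-mono-≤ (m≤m*n n (suc k)) (≤-trans (s≤s z≤n) (m≤n+m (suc k) (triangular k))))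

∏-multiples≈pentagonalSum : ∀ t n f → ∏⟨1+q^ multiples t n ⟩ f ≈[ t * suc n ] pentagonalSum t n f
∏-multiples≈pentagonalSum t n f m m<t[1+n] = begin
  (∏⟨1+q^ multiples t n ⟩ f) m
    ≡⟨ cong (λ es → (∏⟨1+q^ es ⟩ f) m) (multiplesAbove-0 t n) ⟨
  (∏⟨1+q^ multiplesAbove t 0 n ⟩ f) m
    ≡⟨ q^-exponent (∏⟨1+q^ multiplesAbove t 0 n ⟩ f) (trans (cong (t *_) (shanksExponent-0 n)) (*-zeroʳ t)) m ⟨
  shanksTerm t n 0 f m
    ≡⟨ xor-identityʳ _ ⟨
  shanksTerm t n 0 f m xor false
    ≡⟨ cong (shanksTerm t n 0 f m xor_) (⨁-≈𝟘 n (λ k → shanksTerm t n (suc k) f) (λ k _ → shanksTerm-suc≈𝟘 t n k f) m m<t[1+n]) ⟨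
  shanksTerm t n 0 f m xor ⨁ n (λ k → shanksTerm t n (suc k) f) m
    ≡⟨ ⨁-suc n (λ k → shanksTerm t n k f) m ⟨
  shanksSum t n f m
    ≡⟨ shanksSum≗pentagonalSum t n f m ⟩
  pentagonalSum t n f m ∎
  where open ≡-Reasoning

scale : Bool → Series → Series
scale b g m = b ∧ g m

scale-⊕ : ∀ a f g → scale a (f ⊕ g) ≗ scale a f ⊕ scale a g
scale-⊕ a f g m = ∧-distribˡ-xor a (f m) (g m)

q^·-scale : ∀ e b g → q^ e · scale b g ≗ scale b (q^ e · g)
q^·-scale zero b g m = refl
q^·-scale (suc e) b g zero = sym (∧-zeroʳ b)
q^·-scale (suc e) b g (suc m) = q^·-scale e b g m

scale-q^· : ∀ a e e′ f → scale a (q^ e + e′ · f) ≗ q^ e · scale a (q^ e′ · f)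
scale-q^· a e e′ f m = trans (cong (a ∧_) (sym (q^·-q^· e e′ f m))) (sym (q^·-scale e a (q^ e′ · f) m))

infixl 8 _⊛_
_⊛_ : Series → Series → Series
(f ⊛ g) zero = f 0 ∧ g 0
(f ⊛ g) (suc m) = (f 0 ∧ g (suc m)) xor ((λ k → f (suc k)) ⊛ g) m

⊛-unfold : ∀ f g → f ⊛ g ≗ scale (f 0) g ⊕ q^ 1 · ((λ k → f (suc k)) ⊛ g)
⊛-unfold f g zero = sym (xor-identityʳ _)
⊛-unfold f g (suc m) = refl

⊛-congˡ : ∀ {f f′} g → f ≗ f′ → f ⊛ g ≗ f′ ⊛ g
⊛-congˡ g f≗f′ zero = cong (_∧ g 0) (f≗f′ 0)
⊛-congˡ g f≗f′ (suc m) = cong₂ _xor_ (cong (_∧ g (suc m)) (f≗f′ 0)) (⊛-congˡ g (λ k → f≗f′ (suc k)) m)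

⊛-cong≈ : ∀ {f f′ g g′ N} → f ≈[ N ] f′ → g ≈[ N ] g′ → f ⊛ g ≈[ N ] f′ ⊛ g′
⊛-cong≈ f≈f′ g≈g′ zero 0<N = cong₂ _∧_ (f≈f′ 0 0<N) (g≈g′ 0 0<N)
⊛-cong≈ {N = suc N} f≈f′ g≈g′ (suc m) (s≤s m<N) =
  cong₂ _xor_ (cong₂ _∧_ (f≈f′ 0 (s≤s z≤n)) (g≈g′ (suc m) (s≤s m<N)))
              (⊛-cong≈ (λ k k<N → f≈f′ (suc k) (s≤s k<N)) (≈-mono (n≤1+n N) g≈g′) m m<N)

⊛-⊕ˡ : ∀ f f′ g → (f ⊕ f′) ⊛ g ≗ f ⊛ g ⊕ f′ ⊛ g
⊛-⊕ˡ f f′ g zero = ∧-distribʳ-xor (g 0) (f 0) (f′ 0)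
⊛-⊕ˡ f f′ g (suc m) =
  trans (cong₂ _xor_ (∧-distribʳ-xor (g (suc m)) (f 0) (f′ 0)) (⊛-⊕ˡ (λ k → f (suc k)) (λ k → f′ (suc k)) g m))
        (xor-interchange (f 0 ∧ g (suc m)) (f′ 0 ∧ g (suc m)) _ _)

⊛-⊕ʳ : ∀ f g g′ → f ⊛ (g ⊕ g′) ≗ f ⊛ g ⊕ f ⊛ g′
⊛-⊕ʳ f g g′ zero = ∧-distribˡ-xor (f 0) (g 0) (g′ 0)
⊛-⊕ʳ f g g′ (suc m) =
  trans (cong₂ _xor_ (∧-distribˡ-xor (f 0) (g (suc m)) (g′ (suc m))) (⊛-⊕ʳ (λ k → f (suc k)) g g′ m))
        (xor-interchange (f 0 ∧ g (suc m)) (f 0 ∧ g′ (suc m)) _ _)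

𝟘-⊛ : ∀ g → 𝟘 ⊛ g ≗ 𝟘
𝟘-⊛ g zero = refl
𝟘-⊛ g (suc m) = 𝟘-⊛ g m

⊛-𝟙 : ∀ f → f ⊛ 𝟙 ≗ f
⊛-𝟙 f zero = ∧-identityʳ (f 0)
⊛-𝟙 f (suc m) = trans (cong (_xor ((λ k → f (suc k)) ⊛ 𝟙) m) (∧-zeroʳ (f 0))) (⊛-𝟙 (λ k → f (suc k)) m)

q^·-⊛ : ∀ e f g → (q^ e · f) ⊛ g ≗ q^ e · (f ⊛ g)
q^·-⊛ zero f g m = refl
q^·-⊛ (suc e) f g zero = refl
q^·-⊛ (suc e) f g (suc m) = q^·-⊛ e f g m

⊛-q^· : ∀ e f g → f ⊛ (q^ e · g) ≗ q^ e · (f ⊛ g)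
⊛-q^· zero f g m = refl
⊛-q^· (suc e) f g zero = ∧-zeroʳ (f 0)
⊛-q^· (suc e) f g (suc m) = begin
  (f 0 ∧ (q^ e · g) m) xor (f′ ⊛ (q^ suc e · g)) m
    ≡⟨ cong ((f 0 ∧ (q^ e · g) m) xor_) (⊛-q^· (suc e) f′ g m) ⟩
  scale (f 0) (q^ e · g) m xor (q^ suc e · (f′ ⊛ g)) m
    ≡⟨ cong (scale (f 0) (q^ e · g) m xor_) (trans (q^-exponent (f′ ⊛ g) (+-comm 1 e) m) (sym (q^·-q^· e 1 (f′ ⊛ g) m))) ⟩
  scale (f 0) (q^ e · g) m xor (q^ e · q^ 1 · (f′ ⊛ g)) m
    ≡⟨ cong (_xor (q^ e · q^ 1 · (f′ ⊛ g)) m) (q^·-scale e (f 0) g m) ⟨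
  (q^ e · scale (f 0) g) m xor (q^ e · q^ 1 · (f′ ⊛ g)) m
    ≡⟨ q^·-⊕ e (scale (f 0) g) (q^ 1 · (f′ ⊛ g)) m ⟨
  (q^ e · (scale (f 0) g ⊕ q^ 1 · (f′ ⊛ g))) m
    ≡⟨ q^·-cong e (⊛-unfold f g) m ⟨
  (q^ e · (f ⊛ g)) m ∎
  where
  open ≡-Reasoning
  f′ = λ k → f (suc k)

⨁-⊛ : ∀ n F g → ⨁ n F ⊛ g ≗ ⨁ n (λ k → F k ⊛ g)
⨁-⊛ zero F g m = 𝟘-⊛ g m
⨁-⊛ (suc n) F g m = trans (⊛-⊕ˡ (⨁ n F) (F n) g m) (cong (_xor (F n ⊛ g) m) (⨁-⊛ n F g m))

∏-⊛ : ∀ es f g → (∏⟨1+q^ es ⟩ f) ⊛ g ≗ ∏⟨1+q^ es ⟩ (f ⊛ g)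
∏-⊛ [] f g m = refl
∏-⊛ (e ∷ es) f g m =
  trans (⊛-⊕ˡ (∏⟨1+q^ es ⟩ f) (q^ e · ∏⟨1+q^ es ⟩ f) g m)
        (cong₂ _xor_ (∏-⊛ es f g m) (trans (q^·-⊛ e _ g m) (q^·-cong e (∏-⊛ es f g) m)))

⊛-∏ : ∀ es f g → f ⊛ (∏⟨1+q^ es ⟩ g) ≗ ∏⟨1+q^ es ⟩ (f ⊛ g)
⊛-∏ [] f g m = refl
⊛-∏ (e ∷ es) f g m =
  trans (⊛-⊕ʳ f (∏⟨1+q^ es ⟩ g) (q^ e · ∏⟨1+q^ es ⟩ g) m)
        (cong₂ _xor_ (⊛-∏ es f g m) (trans (⊛-q^· e f _ m) (q^·-cong e (⊛-∏ es f g) m)))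

parity : ℕ → Bool
parity zero = false
parity (suc n) = not (parity n)

xorUpTo : ℕ → (ℕ → Bool) → Bool
xorUpTo zero F = false
xorUpTo (suc n) F = xorUpTo n F xor F n

xorUpTo-cong : ∀ n {F G : ℕ → Bool} → (∀ k → k < n → F k ≡ G k) → xorUpTo n F ≡ xorUpTo n G
xorUpTo-cong zero F≡G = refl
xorUpTo-cong (suc n) F≡G = cong₂ _xor_ (xorUpTo-cong n (λ k k<n → F≡G k (m<n⇒m<1+n k<n))) (F≡G n ≤-refl)

xorUpTo-false : ∀ n (F : ℕ → Bool) → (∀ k → k < n → F k ≡ false) → xorUpTo n F ≡ false
xorUpTo-false zero F F≡false = refl
xorUpTo-false (suc n) F F≡false =
  cong₂ _xor_ (xorUpTo-false n F (λ k k<n → F≡false k (m<n⇒m<1+n k<n))) (F≡false n ≤-refl)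

xorUpTo-xor : ∀ n (F G : ℕ → Bool) → xorUpTo n (λ k → F k xor G k) ≡ xorUpTo n F xor xorUpTo n G
xorUpTo-xor zero F G = refl
xorUpTo-xor (suc n) F G =
  trans (cong (_xor (F n xor G n)) (xorUpTo-xor n F G)) (xor-interchange (xorUpTo n F) (xorUpTo n G) (F n) (G n))

xorUpTo-∧ : ∀ n b (F : ℕ → Bool) → b ∧ xorUpTo n F ≡ xorUpTo n (λ k → b ∧ F k)
xorUpTo-∧ zero b F = ∧-zeroʳ b
xorUpTo-∧ (suc n) b F = trans (∧-distribˡ-xor b (xorUpTo n F) (F n)) (cong (_xor (b ∧ F n)) (xorUpTo-∧ n b F))

xorUpTo-comm : ∀ n m (F : ℕ → ℕ → Bool) → xorUpTo n (λ i → xorUpTo m (F i)) ≡ xorUpTo m (λ j → xorUpTo n (λ i → F i j))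
xorUpTo-comm zero m F = sym (xorUpTo-false m _ (λ _ _ → refl))
xorUpTo-comm (suc n) m F =
  trans (cong (_xor xorUpTo m (F n)) (xorUpTo-comm n m F)) (sym (xorUpTo-xor m (λ j → xorUpTo n (λ i → F i j)) (F n)))

xorUpTo-suc : ∀ n (F : ℕ → Bool) → xorUpTo (suc n) F ≡ F 0 xor xorUpTo n (λ k → F (suc k))
xorUpTo-suc zero F = xor-comm false (F 0)
xorUpTo-suc (suc n) F = trans (cong (_xor F (suc n)) (xorUpTo-suc n F)) (xor-assoc (F 0) _ (F (suc n)))

xorUpTo-select : ∀ n c (F : ℕ → Bool) → c < n → xorUpTo n (λ k → (c ≡ᵇ k) ∧ F k) ≡ F c
xorUpTo-select (suc n) c F c<1+n with m≤n⇒m<n∨m≡n (≤-pred c<1+n)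
... | inj₁ c<n = trans (cong₂ _xor_ (xorUpTo-select n c F c<n) (cong (_∧ F n) (dec-false (c ≟ n) (<⇒≢ c<n))))
                       (xor-identityʳ (F c))
... | inj₂ refl = cong₂ _xor_ (xorUpTo-false c _ (λ k k<c → cong (_∧ F k) (dec-false (c ≟ k) (>⇒≢ k<c))))
                              (cong (_∧ F c) (dec-true (c ≟ c) refl))

⨁-at : ∀ n (F : ℕ → Series) m → ⨁ n F m ≡ xorUpTo n (λ k → F k m)
⨁-at zero F m = refl
⨁-at (suc n) F m = cong (_xor F n m) (⨁-at n F m)

⊛-at : ∀ f g n → (f ⊛ g) n ≡ xorUpTo (suc n) (λ i → f i ∧ g (n ∸ i))
⊛-at f g zero = refl
⊛-at f g (suc n) = trans (cong ((f 0 ∧ g (suc n)) xor_) (⊛-at (λ k → f (suc k)) g n))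
                         (sym (xorUpTo-suc (suc n) (λ i → f i ∧ g (suc n ∸ i))))

xorOver : {A : Set} → List A → (A → Bool) → Bool
xorOver [] F = false
xorOver (x ∷ xs) F = F x xor xorOver xs F

xorOver-++ : {A : Set} (xs ys : List A) (F : A → Bool) → xorOver (xs ++ ys) F ≡ xorOver xs F xor xorOver ys F
xorOver-++ [] ys F = refl
xorOver-++ (x ∷ xs) ys F = trans (cong (F x xor_) (xorOver-++ xs ys F)) (sym (xor-assoc (F x) _ _))

module _ {A : Set} where

  xorOver-cong : ∀ (xs : List A) {F G : A → Bool} → (∀ x → F x ≡ G x) → xorOver xs F ≡ xorOver xs G
  xorOver-cong [] F≡G = refl
  xorOver-cong (x ∷ xs) F≡G = cong₂ _xor_ (F≡G x) (xorOver-cong xs F≡G)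

  xorOver-cong-All : ∀ (xs : List A) {F G : A → Bool} → All (λ x → F x ≡ G x) xs → xorOver xs F ≡ xorOver xs G
  xorOver-cong-All [] [] = refl
  xorOver-cong-All (x ∷ xs) (Fx≡Gx ∷ F≡G) = cong₂ _xor_ Fx≡Gx (xorOver-cong-All xs F≡G)

  xorOver-false : ∀ (xs : List A) (F : A → Bool) → (∀ x → F x ≡ false) → xorOver xs F ≡ false
  xorOver-false [] F F≡false = refl
  xorOver-false (x ∷ xs) F F≡false = cong₂ _xor_ (F≡false x) (xorOver-false xs F F≡false)

  xorOver-map : ∀ {B : Set} (h : A → B) xs (F : B → Bool) → xorOver (map h xs) F ≡ xorOver xs (λ x → F (h x))
  xorOver-map h [] F = refl
  xorOver-map h (x ∷ xs) F = cong (F (h x) xor_) (xorOver-map h xs F)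

  xorOver-concatMap : ∀ {B : Set} (h : A → List B) xs (F : B → Bool) → xorOver (concatMap h xs) F ≡ xorOver xs (λ x → xorOver (h x) F)
  xorOver-concatMap h [] F = refl
  xorOver-concatMap h (x ∷ xs) F =
    trans (xorOver-++ (h x) (concatMap h xs) F) (cong (xorOver (h x) F xor_) (xorOver-concatMap h xs F))

  xorOver-∧ : ∀ (xs : List A) b (F : A → Bool) → b ∧ xorOver xs F ≡ xorOver xs (λ x → b ∧ F x)
  xorOver-∧ [] b F = ∧-zeroʳ b
  xorOver-∧ (x ∷ xs) b F = trans (∧-distribˡ-xor b (F x) (xorOver xs F)) (cong ((b ∧ F x) xor_) (xorOver-∧ xs b F))

  xorOver-xorUpTo : ∀ (xs : List A) n (F : A → ℕ → Bool) →
    xorOver xs (λ x → xorUpTo n (F x)) ≡ xorUpTo n (λ k → xorOver xs (λ x → F x k))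
  xorOver-xorUpTo [] n F = sym (xorUpTo-false n _ (λ _ _ → refl))
  xorOver-xorUpTo (x ∷ xs) n F = trans (cong (xorUpTo n (F x) xor_) (xorOver-xorUpTo xs n F)) (sym (xorUpTo-xor n (F x) _))

  parity-filter : ∀ {P : A → Set} (P? : (x : A) → Dec (P x)) xs → parity (length (filter P? xs)) ≡ xorOver xs (λ x → does (P? x))
  parity-filter P? [] = refl
  parity-filter P? (x ∷ xs) with does (P? x)
  ... | false = parity-filter P? xs
  ... | true = cong not (parity-filter P? xs)

xorOver-applyUpTo : ∀ (h : ℕ → ℕ) n (F : ℕ → Bool) → xorOver (applyUpTo h n) F ≡ xorUpTo n (λ k → F (h k))
xorOver-applyUpTo h zero F = refl
xorOver-applyUpTo h (suc n) F =
  trans (cong (F (h 0) xor_) (xorOver-applyUpTo (λ k → h (suc k)) n F)) (sym (xorUpTo-suc n (λ k → F (h k))))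

xorOver-upTo : ∀ n (F : ℕ → Bool) → xorOver (upTo n) F ≡ xorUpTo n F
xorOver-upTo = xorOver-applyUpTo (λ k → k)

admissible : ℕ → ℕ → Bool
admissible b x = does (admissible? b 4 x)

allAdmissible : ℕ → Partition → Bool
allAdmissible b γ = does (all? (admissible? b 4) γ)

-- Coefficient m of partitionGF≤ b k j is the parity of the number of partitions of m into
-- exactly j parts, all ≤ k and ≡ b (mod 4); the recursion is on whether k is a part.
partitionGF≤ : ℕ → ℕ → ℕ → Series
partitionGF≤ b k zero = 𝟙
partitionGF≤ b zero (suc j) = 𝟘
partitionGF≤ b (suc k) (suc j) =
  partitionGF≤ b k (suc j) ⊕ scale (admissible b (suc k)) (q^ suc k · partitionGF≤ b (suc k) j)

partitionGF≤-at-0 : ∀ b k j → partitionGF≤ b k j 0 ≡ (0 ≡ᵇ j)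
partitionGF≤-at-0 b k zero = refl
partitionGF≤-at-0 b zero (suc j) = refl
partitionGF≤-at-0 b (suc k) (suc j) =
  trans (cong₂ _xor_ (partitionGF≤-at-0 b k (suc j)) (∧-zeroʳ (admissible b (suc k)))) refl

boundedPartitions-size-length : ∀ f m k → All (λ γ → sum γ ≡ m × length γ ≤ m) (boundedPartitions f m k)
boundedPartitions-size-length zero zero k = (refl , z≤n) ∷ []
boundedPartitions-size-length zero (suc m) k = []
boundedPartitions-size-length (suc f) zero k = (refl , z≤n) ∷ []
boundedPartitions-size-length (suc f) (suc m) k =
  concat⁺ (map⁺ (applyUpTo⁺₁ (λ i → i) (k ⊓ suc m) (λ {i} i<k⊓1+m →
    map⁺ (All.map (λ {γ} → cons-ok i (<-≤-trans i<k⊓1+m (m⊓n≤n k (suc m))) {γ})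
         (boundedPartitions-size-length f (suc m ∸ suc i) (suc i))))))
  where
  cons-ok : ∀ i → i < suc m → ∀ {γ} → sum γ ≡ m ∸ i × length γ ≤ m ∸ i →
            sum (suc i ∷ γ) ≡ suc m × length (suc i ∷ γ) ≤ suc m
  cons-ok i (s≤s i≤m) (size-γ , length-γ) =
    cong suc (trans (cong (i +_) size-γ) (m+[n∸m]≡n i≤m)) , s≤s (≤-trans length-γ (m∸n≤m m i))

partitionGF≤-largest-part : ∀ b j m k →
  xorUpTo (k ⊓ suc m) (λ i → admissible b (suc i) ∧ partitionGF≤ b (suc i) j (m ∸ i)) ≡ partitionGF≤ b k (suc j) (suc m)
partitionGF≤-largest-part b j m zero = refl
partitionGF≤-largest-part b j m (suc k) with k ≤? m
... | yes k≤m = begin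
  xorUpTo (suc (k ⊓ m)) F
    ≡⟨ cong (λ x → xorUpTo (suc x) F) (m≤n⇒m⊓n≡m k≤m) ⟩
  xorUpTo k F xor F k
    ≡⟨ cong₂ _xor_ (trans (cong (λ x → xorUpTo x F) (sym (m≤n⇒m⊓n≡m (≤-trans k≤m (n≤1+n m)))))
                          (partitionGF≤-largest-part b j m k))
                   (cong (admissible b (suc k) ∧_) (sym (q^·-above k (partitionGF≤ b (suc k) j) m k≤m))) ⟩
  partitionGF≤ b (suc k) (suc j) (suc m) ∎
  where
  open ≡-Reasoning
  F = λ i → admissible b (suc i) ∧ partitionGF≤ b (suc i) j (m ∸ i)
... | no k≰m = begin
  xorUpTo (suc (k ⊓ m)) F
    ≡⟨ cong (λ x → xorUpTo (suc x) F) (m≥n⇒m⊓n≡n m≤k) ⟩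
  xorUpTo (suc m) F
    ≡⟨ cong (λ x → xorUpTo x F) (sym (m≥n⇒m⊓n≡n (≰⇒> k≰m))) ⟩
  xorUpTo (k ⊓ suc m) F
    ≡⟨ partitionGF≤-largest-part b j m k ⟩
  partitionGF≤ b k (suc j) (suc m)
    ≡⟨ xor-identityʳ _ ⟨
  partitionGF≤ b k (suc j) (suc m) xor false
    ≡⟨ cong (partitionGF≤ b k (suc j) (suc m) xor_)
            (sym (trans (cong (admissible b (suc k) ∧_) (q^·-below k (partitionGF≤ b (suc k) j) m (≰⇒> k≰m))) (∧-zeroʳ _))) ⟩
  partitionGF≤ b (suc k) (suc j) (suc m) ∎
  where
  open ≡-Reasoning
  F = λ i → admissible b (suc i) ∧ partitionGF≤ b (suc i) j (m ∸ i)
  m≤k = ≤-trans (n≤1+n m) (≰⇒> k≰m)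

partitionGF≤-counts : ∀ b f m k j → m ≤ f →
  xorOver (boundedPartitions f m k) (λ γ → allAdmissible b γ ∧ (length γ ≡ᵇ j)) ≡ partitionGF≤ b k j m
partitionGF≤-counts b zero zero k j _ = trans (xor-identityʳ _) (sym (partitionGF≤-at-0 b k j))
partitionGF≤-counts b (suc f) zero k j _ = trans (xor-identityʳ _) (sym (partitionGF≤-at-0 b k j))
partitionGF≤-counts b (suc f) (suc m) k zero _ =
  trans (xorOver-concatMap _ (upTo (k ⊓ suc m)) _)
        (xorOver-false (upTo (k ⊓ suc m)) _ (λ i →
          trans (xorOver-map (suc i ∷_) (boundedPartitions f (m ∸ i) (suc i)) _)
                (xorOver-false (boundedPartitions f (m ∸ i) (suc i)) _ (λ γ → ∧-zeroʳ (allAdmissible b (suc i ∷ γ))))))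
partitionGF≤-counts b (suc f) (suc m) k (suc j) (s≤s m≤f) =
  trans (xorOver-concatMap _ (upTo (k ⊓ suc m)) _)
        (trans (xorOver-cong (upTo (k ⊓ suc m)) largest)
               (trans (xorOver-upTo (k ⊓ suc m) _) (partitionGF≤-largest-part b j m k)))
  where
  largest : ∀ i → xorOver (map (suc i ∷_) (boundedPartitions f (suc m ∸ suc i) (suc i))) (λ γ → allAdmissible b γ ∧ (length γ ≡ᵇ suc j))
                ≡ admissible b (suc i) ∧ partitionGF≤ b (suc i) j (m ∸ i)
  largest i = begin
    xorOver (map (suc i ∷_) Γ) (λ γ → allAdmissible b γ ∧ (length γ ≡ᵇ suc j))
      ≡⟨ xorOver-map (suc i ∷_) Γ _ ⟩
    xorOver Γ (λ γ → (admissible b (suc i) ∧ allAdmissible b γ) ∧ (length γ ≡ᵇ j))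
      ≡⟨ xorOver-cong Γ (λ γ → ∧-assoc (admissible b (suc i)) (allAdmissible b γ) (length γ ≡ᵇ j)) ⟩
    xorOver Γ (λ γ → admissible b (suc i) ∧ (allAdmissible b γ ∧ (length γ ≡ᵇ j)))
      ≡⟨ xorOver-∧ Γ (admissible b (suc i)) _ ⟨
    admissible b (suc i) ∧ xorOver Γ (λ γ → allAdmissible b γ ∧ (length γ ≡ᵇ j))
      ≡⟨ cong (admissible b (suc i) ∧_) (partitionGF≤-counts b f (m ∸ i) (suc i) j (≤-trans (m∸n≤m m i) m≤f)) ⟩
    admissible b (suc i) ∧ partitionGF≤ b (suc i) j (m ∸ i) ∎
    where
    open ≡-Reasoning
    Γ = boundedPartitions f (m ∸ i) (suc i)

partitionGF : ℕ → ℕ → Series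
partitionGF b j m = partitionGF≤ b m j m

partitionGF-counts : ∀ b j m → xorOver (partitions m) (λ γ → allAdmissible b γ ∧ (length γ ≡ᵇ j)) ≡ partitionGF b j m
partitionGF-counts b j m = partitionGF≤-counts b m m m j ≤-refl

partitionGF≤-stable-suc : ∀ b k j m → m ≤ k → partitionGF≤ b (suc k) j m ≡ partitionGF≤ b k j m
partitionGF≤-stable-suc b k zero m _ = refl
partitionGF≤-stable-suc b k (suc j) m m≤k =
  trans (cong (partitionGF≤ b k (suc j) m xor_)
              (trans (cong (admissible b (suc k) ∧_) (q^·-below (suc k) _ m (s≤s m≤k))) (∧-zeroʳ _)))
        (xor-identityʳ _)

partitionGF≤-stable : ∀ b k j m → m ≤ k → partitionGF≤ b k j m ≡ partitionGF b j m
partitionGF≤-stable b k j m m≤k = trans (cong (λ x → partitionGF≤ b x j m) (sym (m∸n+n≡m m≤k))) (stable (k ∸ m))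
  where
  stable : ∀ d → partitionGF≤ b (d + m) j m ≡ partitionGF b j m
  stable zero = refl
  stable (suc d) = trans (partitionGF≤-stable-suc b (d + m) j m (m≤n+m m d)) (stable d)

partitionGF≤-below-length : ∀ b k j m → m < j → partitionGF≤ b k j m ≡ false
partitionGF≤-below-length b zero (suc j) m _ = refl
partitionGF≤-below-length b (suc k) (suc j) m m<1+j =
  trans (cong₂ _xor_ (partitionGF≤-below-length b k (suc j) m m<1+j)
                     (trans (cong (admissible b (suc k) ∧_) shifted) (∧-zeroʳ _))) refl
  where
  shifted : (q^ suc k · partitionGF≤ b (suc k) j) m ≡ false
  shifted with suc k ≤? m
  ... | yes k<m = trans (q^·-above (suc k) _ m k<m)
                        (partitionGF≤-below-length b (suc k) j (m ∸ suc k) (<-≤-trans (∸-monoʳ-< z<s k<m) (≤-pred m<1+j)))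
  ... | no k≮m = q^·-below (suc k) _ m (≰⇒> k≮m)

partitionGF≈𝟘 : ∀ b j → partitionGF b j ≈[ j ] 𝟘
partitionGF≈𝟘 b j m m<j = partitionGF≤-below-length b m j m m<j

admissible-periodic : ∀ b x → b ≤ x → admissible b (4 + x) ≡ admissible b x
admissible-periodic b x b≤x =
  cong₂ _∧_ (trans (dec-true (b ≤? 4 + x) (≤-trans b≤x (m≤n+m x 4))) (sym (dec-true (b ≤? x) b≤x)))
            (cong (λ y → does (4 ∣? y)) (+-∸-assoc 4 b≤x))

partitionGF≤-skip : ∀ b k j → admissible b (suc k) ≡ false → partitionGF≤ b (suc k) j ≗ partitionGF≤ b k j
partitionGF≤-skip b k zero _ m = refl
partitionGF≤-skip b k (suc j) inadmissible m =
  trans (cong (λ a → partitionGF≤ b k (suc j) m xor (a ∧ (q^ suc k · partitionGF≤ b (suc k) j) m)) inadmissible)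
        (xor-identityʳ _)

-- Removing the smallest part of a partition into parts ≡ b (mod 4): either it equals b,
-- or all parts exceed b and may be lowered by 4.
module SmallestPart (b : ℕ)
  (periodic : ∀ d → admissible b (5 + d) ≡ admissible b (suc d))
  (base : ∀ j → partitionGF≤ b 4 (suc j) ≗ q^ b · partitionGF≤ b 4 j) where

  smallest-part : ∀ d j →
    partitionGF≤ b (4 + d) (suc j) ≗ q^ b · partitionGF≤ b (4 + d) j ⊕ q^ 4 * suc j · partitionGF≤ b d (suc j)
  smallest-part zero j m = trans (base j m) (sym (trans (cong ((q^ b · partitionGF≤ b 4 j) m xor_) (q^·-𝟘 (4 * suc j) m))
                                                       (xor-identityʳ _)))
  smallest-part (suc d) zero m = begin
    (G (4 + d) 1 ⊕ scale a (q^ 5 + d · 𝟙)) m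
      ≡⟨ cong (_xor scale a (q^ 5 + d · 𝟙) m) (smallest-part d zero m) ⟩
    ((q^ b · 𝟙 ⊕ q^ 4 · G d 1) ⊕ scale a (q^ 5 + d · 𝟙)) m
      ≡⟨ xor-assoc ((q^ b · 𝟙) m) _ _ ⟩
    (q^ b · 𝟙 ⊕ (q^ 4 · G d 1 ⊕ scale a (q^ 5 + d · 𝟙))) m
      ≡⟨ cong (λ x → (q^ b · 𝟙) m xor ((q^ 4 · G d 1) m xor x))
              (trans (scale-q^· a 4 (suc d) 𝟙 m) (cong (λ a′ → (q^ 4 · scale a′ (q^ suc d · 𝟙)) m) (periodic d))) ⟩
    (q^ b · 𝟙 ⊕ (q^ 4 · G d 1 ⊕ q^ 4 · scale (admissible b (suc d)) (q^ suc d · 𝟙))) m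
      ≡⟨ cong ((q^ b · 𝟙) m xor_) (q^·-⊕ 4 (G d 1) _ m) ⟨
    (q^ b · G (5 + d) 0 ⊕ q^ 4 · G (suc d) 1) m ∎
    where
    open ≡-Reasoning
    G = partitionGF≤ b
    a = admissible b (5 + d)
  smallest-part (suc d) (suc j) m = begin
    (G (4 + d) (suc J) ⊕ scale a (q^ 5 + d · G (5 + d) J)) m
      ≡⟨ cong₂ _xor_ (smallest-part d (suc j) m) (cong (a ∧_) (q^·-cong (5 + d) (smallest-part (suc d) j) m)) ⟩
    (P ⊕ Q) m xor (a ∧ (q^ 5 + d · (R ⊕ S)) m)
      ≡⟨ cong (λ x → (P ⊕ Q) m xor (a ∧ x)) (q^·-⊕ (5 + d) R S m) ⟩
    (P ⊕ Q) m xor scale a (q^ 5 + d · R ⊕ q^ 5 + d · S) m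
      ≡⟨ cong ((P ⊕ Q) m xor_) (scale-⊕ a (q^ 5 + d · R) (q^ 5 + d · S) m) ⟩
    ((P ⊕ Q) ⊕ (scale a (q^ 5 + d · R) ⊕ scale a (q^ 5 + d · S))) m
      ≡⟨ ⊕-interchange P Q (scale a (q^ 5 + d · R)) (scale a (q^ 5 + d · S)) m ⟩
    ((P ⊕ scale a (q^ 5 + d · R)) ⊕ (Q ⊕ scale a (q^ 5 + d · S))) m
      ≡⟨ cong₂ _xor_ (cong (P m xor_) lowered-by-b) (cong (Q m xor_) lowered-by-4) ⟩
    ((P ⊕ q^ b · scale a (q^ 5 + d · G (5 + d) j)) ⊕ (Q ⊕ q^ 4 * suc J · scale a (q^ suc d · G (suc d) J))) m
      ≡⟨ cong₂ _xor_ (q^·-⊕ b (G (4 + d) J) _ m) (q^·-⊕ (4 * suc J) (G d (suc J)) _ m) ⟨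
    (q^ b · G (5 + d) J) m xor (q^ 4 * suc J · (G d (suc J) ⊕ scale a (q^ suc d · G (suc d) J))) m
      ≡⟨ cong (λ x → (q^ b · G (5 + d) J) m xor (q^ 4 * suc J · (G d (suc J) ⊕ scale x (q^ suc d · G (suc d) J))) m)
              (periodic d) ⟩
    (q^ b · G (5 + d) J ⊕ q^ 4 * suc J · G (suc d) (suc J)) m ∎
    where
    open ≡-Reasoning
    G = partitionGF≤ b
    J = suc j
    a = admissible b (5 + d)
    P = q^ b · G (4 + d) J
    Q = q^ 4 * suc J · G d (suc J)
    R = q^ b · G (5 + d) j
    S = q^ 4 * J · G (suc d) J
    lowered-by-b : scale a (q^ 5 + d · R) m ≡ (q^ b · scale a (q^ 5 + d · G (5 + d) j)) m
    lowered-by-b = trans (cong (a ∧_) (q^·-comm (5 + d) b _ m)) (sym (q^·-scale b a _ m))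
    lowered-by-4 : scale a (q^ 5 + d · S) m ≡ (q^ 4 * suc J · scale a (q^ suc d · G (suc d) J)) m
    lowered-by-4 = trans (cong (a ∧_) (trans (q^·-q^· (5 + d) (4 * J) _ m) (q^-exponent _ (exponent d J) m)))
                         (scale-q^· a (4 * suc J) (suc d) _ m)
      where
      exponent : ∀ d J → 5 + d + 4 * J ≡ 4 * suc J + suc d
      exponent = solve-∀

  partitionGF-recurrence : ∀ j → ⟨1+q^ 4 * suc j ⟩ partitionGF b (suc j) ≗ q^ b · partitionGF b j
  partitionGF-recurrence j m = begin
    partitionGF b (suc j) m xor Z m
      ≡⟨ cong (_xor Z m) (partitionGF≤-stable b (4 + m) (suc j) m (m≤n+m m 4)) ⟨
    partitionGF≤ b (4 + m) (suc j) m xor Z m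
      ≡⟨ cong (_xor Z m) (smallest-part m j m) ⟩
    ((q^ b · partitionGF≤ b (4 + m) j) m xor (q^ 4 * suc j · partitionGF≤ b m (suc j)) m) xor Z m
      ≡⟨ cong₂ (λ x y → (x xor y) xor Z m) (q^·-cong≈ b (stable (4 + m) j (λ x≤m → ≤-trans x≤m (m≤n+m m 4))) m ≤-refl)
                                           (q^·-cong≈ (4 * suc j) (stable m (suc j) (λ x≤m → x≤m)) m ≤-refl) ⟩
    ((q^ b · partitionGF b j) m xor Z m) xor Z m
      ≡⟨ xor-cancelʳ-inverse ((q^ b · partitionGF b j) m) (Z m) ⟩
    (q^ b · partitionGF b j) m ∎
    where
    open ≡-Reasoning
    Z = q^ 4 * suc j · partitionGF b (suc j)
    stable : ∀ k j → (∀ {x} → x ≤ m → x ≤ k) → partitionGF≤ b k j ≈[ suc m ] partitionGF b j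
    stable k j x≤k x x<1+m = partitionGF≤-stable b k j x (x≤k (≤-pred x<1+m))

partitionGF≤-1-base : ∀ j → partitionGF≤ 1 4 (suc j) ≗ q^ 1 · partitionGF≤ 1 4 j
partitionGF≤-1-base j m = trans (skip-to-1 (suc j) m) (q^·-cong 1 (λ m′ → sym (skip-to-1 j m′)) m)
  where
  skip-to-1 : ∀ j → partitionGF≤ 1 4 j ≗ partitionGF≤ 1 1 j
  skip-to-1 j m = trans (partitionGF≤-skip 1 3 j refl m) (trans (partitionGF≤-skip 1 2 j refl m) (partitionGF≤-skip 1 1 j refl m))

partitionGF≤-3-base : ∀ j → partitionGF≤ 3 4 (suc j) ≗ q^ 3 · partitionGF≤ 3 4 j
partitionGF≤-3-base j m = begin
  partitionGF≤ 3 4 (suc j) m                                   ≡⟨ partitionGF≤-skip 3 3 (suc j) refl m ⟩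
  partitionGF≤ 3 2 (suc j) m xor (q^ 3 · partitionGF≤ 3 3 j) m  ≡⟨ cong (_xor (q^ 3 · partitionGF≤ 3 3 j) m) no-smaller-parts ⟩
  (q^ 3 · partitionGF≤ 3 3 j) m                                 ≡⟨ q^·-cong 3 (partitionGF≤-skip 3 3 j refl) m ⟨
  (q^ 3 · partitionGF≤ 3 4 j) m                                 ∎
  where
  open ≡-Reasoning
  no-smaller-parts : partitionGF≤ 3 2 (suc j) m ≡ false
  no-smaller-parts = trans (partitionGF≤-skip 3 1 (suc j) refl m) (partitionGF≤-skip 3 0 (suc j) refl m)

admissible-3-periodic : ∀ d → admissible 3 (5 + d) ≡ admissible 3 (suc d)
admissible-3-periodic zero = refl
admissible-3-periodic (suc zero) = refl
admissible-3-periodic (suc (suc d)) = admissible-periodic 3 (3 + d) (s≤s (s≤s (s≤s z≤n)))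

partitionGF-1-recurrence : ∀ j → ⟨1+q^ 4 * suc j ⟩ partitionGF 1 (suc j) ≗ q^ 1 · partitionGF 1 j
partitionGF-1-recurrence = SmallestPart.partitionGF-recurrence 1 (λ d → admissible-periodic 1 (suc d) (s≤s z≤n)) partitionGF≤-1-base

partitionGF-3-recurrence : ∀ j → ⟨1+q^ 4 * suc j ⟩ partitionGF 3 (suc j) ≗ q^ 3 · partitionGF 3 j
partitionGF-3-recurrence = SmallestPart.partitionGF-recurrence 3 admissible-3-periodic partitionGF≤-3-base

progression : ℕ → ℕ → List ℕ
progression c zero = []
progression c (suc M) = c + 4 * M ∷ progression c M

∏-odds-split : ∀ M f → ∏⟨1+q^ odds (M + M) ⟩ f ≗ ∏⟨1+q^ progression 1 M ⟩ ∏⟨1+q^ progression 3 M ⟩ f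
∏-odds-split zero f m = refl
∏-odds-split (suc M) f m = begin
  (∏⟨1+q^ odds (suc M + suc M) ⟩ f) m
    ≡⟨ cong (λ k → (∏⟨1+q^ odds k ⟩ f) m) (+-suc (suc M) M) ⟩
  (⟨1+q^ suc (suc (M + M) + suc (M + M)) ⟩ ⟨1+q^ suc (M + M + (M + M)) ⟩ O) m
    ≡⟨ trans (1+q^-exponent (⟨1+q^ suc (M + M + (M + M)) ⟩ O) (3+4M M) m) (1+q^-cong (3 + 4 * M) (1+q^-exponent O (1+4M M)) m) ⟩
  (⟨1+q^ 3 + 4 * M ⟩ ⟨1+q^ 1 + 4 * M ⟩ O) m
    ≡⟨ 1+q^-cong (3 + 4 * M) (1+q^-cong (1 + 4 * M) (∏-odds-split M f)) m ⟩
  (⟨1+q^ 3 + 4 * M ⟩ ⟨1+q^ 1 + 4 * M ⟩ ∏⟨1+q^ progression 1 M ⟩ ∏⟨1+q^ progression 3 M ⟩ f) m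
    ≡⟨ 1+q^-comm (3 + 4 * M) (1 + 4 * M) (∏⟨1+q^ progression 1 M ⟩ ∏⟨1+q^ progression 3 M ⟩ f) m ⟩
  (⟨1+q^ 1 + 4 * M ⟩ ⟨1+q^ 3 + 4 * M ⟩ ∏⟨1+q^ progression 1 M ⟩ ∏⟨1+q^ progression 3 M ⟩ f) m
    ≡⟨ 1+q^-cong (1 + 4 * M) (∏-1+q^ (progression 1 M) (3 + 4 * M) (∏⟨1+q^ progression 3 M ⟩ f)) m ⟨
  (∏⟨1+q^ progression 1 (suc M) ⟩ ∏⟨1+q^ progression 3 (suc M) ⟩ f) m ∎
  where
  open ≡-Reasoning
  O = ∏⟨1+q^ odds (M + M) ⟩ f
  3+4M : ∀ M → suc (suc (M + M) + suc (M + M)) ≡ 3 + 4 * M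
  3+4M = solve-∀
  1+4M : ∀ M → suc (M + M + (M + M)) ≡ 1 + 4 * M
  1+4M = solve-∀

-- Truncation of Σ_l q^(4jl) q^l / (q⁴;q⁴)_l = 1 / (q^(1+4j);q⁴)_∞.
eulerGF : ℕ → ℕ → Series
eulerGF L j = ⨁ L (λ l → q^ l * (4 * j) · partitionGF 1 l)

eulerGF-telescope : ∀ L j → eulerGF (suc L) j ⊕ eulerGF (suc L) (suc j) ≗ q^ 1 + 4 * j · eulerGF L j
eulerGF-telescope L j m = begin
  (eulerGF (suc L) j ⊕ eulerGF (suc L) (suc j)) m   ≡⟨ ⨁-⊕ (suc L) T _ m ⟨
  ⨁ (suc L) (λ l → T l ⊕ q^ l * (4 * suc j) · partitionGF 1 l) m
                                                     ≡⟨ ⨁-cong (suc L) (λ l _ → pair l) m ⟩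
  ⨁ (suc L) F m                                     ≡⟨ ⨁-suc L F m ⟩
  F 0 m xor ⨁ L (λ l → F (suc l)) m                ≡⟨ cong₂ _xor_ (xor-same (partitionGF 1 0 m)) (⨁-cong L (λ l _ → shifted l) m) ⟩
  ⨁ L (λ l → q^ 1 + 4 * j · T l) m                 ≡⟨ q^·-⨁ (1 + 4 * j) L T m ⟨
  (q^ 1 + 4 * j · eulerGF L j) m                    ∎
  where
  open ≡-Reasoning
  T : ℕ → Series
  T l = q^ l * (4 * j) · partitionGF 1 l
  F : ℕ → Series
  F l = q^ l * (4 * j) · ⟨1+q^ 4 * l ⟩ partitionGF 1 l
  pair : ∀ l → T l ⊕ q^ l * (4 * suc j) · partitionGF 1 l ≗ F l
  pair l m = sym (trans (q^·-⊕ (l * (4 * j)) (partitionGF 1 l) _ m)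
                        (cong (T l m xor_) (trans (q^·-q^· (l * (4 * j)) (4 * l) _ m) (q^-exponent _ (sym (exponent l j)) m))))
    where
    exponent : ∀ l j → l * (4 * suc j) ≡ l * (4 * j) + 4 * l
    exponent = solve-∀
  shifted : ∀ l → F (suc l) ≗ q^ 1 + 4 * j · T l
  shifted l m = begin
    F (suc l) m                                          ≡⟨ q^·-cong (suc l * (4 * j)) (partitionGF-1-recurrence l) m ⟩
    (q^ suc l * (4 * j) · q^ 1 · partitionGF 1 l) m     ≡⟨ q^·-q^· (suc l * (4 * j)) 1 _ m ⟩
    (q^ suc l * (4 * j) + 1 · partitionGF 1 l) m        ≡⟨ q^-exponent _ (exponent l j) m ⟩
    (q^ (1 + 4 * j) + l * (4 * j) · partitionGF 1 l) m  ≡⟨ q^·-q^· (1 + 4 * j) (l * (4 * j)) _ m ⟨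
    (q^ 1 + 4 * j · T l) m                               ∎
    where
    exponent : ∀ l j → suc l * (4 * j) + 1 ≡ (1 + 4 * j) + l * (4 * j)
    exponent = solve-∀

-- Euler's identity 1 / (q^(5+4j);q⁴)_∞ = (1 - q^(1+4j)) / (q^(1+4j);q⁴)_∞, up to the truncation.
eulerGF-step : ∀ L N j → N ≤ L → eulerGF (suc L) (suc j) ≈[ N ] ⟨1+q^ 1 + 4 * j ⟩ eulerGF (suc L) j
eulerGF-step L N j N≤L = ⊕-solve {eulerGF (suc L) j}
  (≈-trans (≗⇒≈ N (eulerGF-telescope L j)) (q^·-cong≈ (1 + 4 * j) (≈-sym (⨁-drop-last L _ last≈𝟘))))
  where
  last≈𝟘 : q^ L * (4 * j) · partitionGF 1 L ≈[ N ] 𝟘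
  last≈𝟘 = ≈-mono N≤L (q^·-preserves-≈𝟘 (L * (4 * j)) (partitionGF≈𝟘 1 L))

eulerGF-∏ : ∀ L N j → N ≤ L → eulerGF (suc L) j ≈[ N ] ∏⟨1+q^ progression 1 j ⟩ eulerGF (suc L) 0
eulerGF-∏ L N zero N≤L m _ = refl
eulerGF-∏ L N (suc j) N≤L = ≈-trans (eulerGF-step L N j N≤L) (1+q^-cong≈ (1 + 4 * j) (eulerGF-∏ L N j N≤L))

eulerGF≈𝟙 : ∀ L N M → N ≤ 4 * M → eulerGF (suc L) M ≈[ N ] 𝟙
eulerGF≈𝟙 L N M N≤4M m m<N = trans (⨁-suc L _ m)
  (trans (cong (𝟙 m xor_) (⨁-≈𝟘 L _ (λ l _ → q^·≈𝟘 (suc l * (4 * M)) _ (≤-trans N≤4M (m≤m+n (4 * M) (l * (4 * M))))) m m<N))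
         (xor-identityʳ (𝟙 m)))

qBinomialTerm : ℕ → Series
qBinomialTerm j = ∏⟨1+q^ progression 1 j ⟩ partitionGF 3 j

qBinomialTerm≈𝟘 : ∀ j → qBinomialTerm j ≈[ j ] 𝟘
qBinomialTerm≈𝟘 j = ∏-preserves-≈𝟘 (progression 1 j) (partitionGF≈𝟘 3 j)

-- Truncation of Σ_j q^(4js) (q;q⁴)_j q^(3j) / (q⁴;q⁴)_j = (q^(4+4s);q⁴)_∞ / (q^(3+4s);q⁴)_∞.
qBinomialGF : ℕ → ℕ → Series
qBinomialGF J s = ⨁ J (λ j → q^ j * (4 * s) · qBinomialTerm j)

qBinomialTerm-recurrence : ∀ j → ⟨1+q^ 4 * suc j ⟩ qBinomialTerm (suc j) ≗ ⟨1+q^ 1 + 4 * j ⟩ q^ 3 · qBinomialTerm j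
qBinomialTerm-recurrence j m = begin
  (⟨1+q^ 4 * suc j ⟩ ∏⟨1+q^ progression 1 (suc j) ⟩ partitionGF 3 (suc j)) m
    ≡⟨ ∏-1+q^ (progression 1 (suc j)) (4 * suc j) (partitionGF 3 (suc j)) m ⟨
  (∏⟨1+q^ progression 1 (suc j) ⟩ ⟨1+q^ 4 * suc j ⟩ partitionGF 3 (suc j)) m
    ≡⟨ ∏-cong (progression 1 (suc j)) (partitionGF-3-recurrence j) m ⟩
  (⟨1+q^ 1 + 4 * j ⟩ ∏⟨1+q^ progression 1 j ⟩ q^ 3 · partitionGF 3 j) m
    ≡⟨ 1+q^-cong (1 + 4 * j) (∏-q^· (progression 1 j) 3 (partitionGF 3 j)) m ⟩
  (⟨1+q^ 1 + 4 * j ⟩ q^ 3 · qBinomialTerm j) m ∎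
  where open ≡-Reasoning

qBinomialGF-telescope : ∀ J s → qBinomialGF (suc J) s ⊕ qBinomialGF (suc J) (suc s)
                                ≗ q^ 3 + 4 * s · qBinomialGF J s ⊕ q^ 4 * suc s · qBinomialGF J (suc s)
qBinomialGF-telescope J s m = begin
  (qBinomialGF (suc J) s ⊕ qBinomialGF (suc J) (suc s)) m
    ≡⟨ ⨁-⊕ (suc J) (λ j → q^ j * (4 * s) · Z j) (λ j → q^ j * (4 * suc s) · Z j) m ⟨
  ⨁ (suc J) (λ j → q^ j * (4 * s) · Z j ⊕ q^ j * (4 * suc s) · Z j) m
    ≡⟨ ⨁-cong (suc J) (λ j _ → pair j) m ⟩
  ⨁ (suc J) F m
    ≡⟨ ⨁-suc J F m ⟩
  F 0 m xor ⨁ J (λ j → F (suc j)) m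
    ≡⟨ cong₂ _xor_ (xor-same (Z 0 m)) (⨁-cong J (λ j _ → shifted j) m) ⟩
  ⨁ J (λ j → A j ⊕ B j) m
    ≡⟨ ⨁-⊕ J A B m ⟩
  ⨁ J A m xor ⨁ J B m
    ≡⟨ cong₂ _xor_ (q^·-⨁ (3 + 4 * s) J _ m) (q^·-⨁ (4 * suc s) J _ m) ⟨
  (q^ 3 + 4 * s · qBinomialGF J s ⊕ q^ 4 * suc s · qBinomialGF J (suc s)) m ∎
  where
  open ≡-Reasoning
  Z = qBinomialTerm
  F : ℕ → Series
  F j = q^ j * (4 * s) · ⟨1+q^ 4 * j ⟩ Z j
  A B : ℕ → Series
  A j = q^ 3 + 4 * s · q^ j * (4 * s) · Z j
  B j = q^ 4 * suc s · q^ j * (4 * suc s) · Z j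
  pair : ∀ j → q^ j * (4 * s) · Z j ⊕ q^ j * (4 * suc s) · Z j ≗ F j
  pair j m = sym (trans (q^·-⊕ (j * (4 * s)) (Z j) _ m)
                        (cong ((q^ j * (4 * s) · Z j) m xor_) (trans (q^·-q^· (j * (4 * s)) (4 * j) (Z j) m)
                                                                     (q^-exponent (Z j) (sym (exponent j s)) m))))
    where
    exponent : ∀ j s → j * (4 * suc s) ≡ j * (4 * s) + 4 * j
    exponent = solve-∀
  shifted : ∀ j → F (suc j) ≗ A j ⊕ B j
  shifted j m = begin
    (q^ a · ⟨1+q^ 4 * suc j ⟩ Z (suc j)) m
      ≡⟨ q^·-cong a (qBinomialTerm-recurrence j) m ⟩
    (q^ a · (q^ 3 · Z j ⊕ q^ 1 + 4 * j · q^ 3 · Z j)) m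
      ≡⟨ q^·-⊕ a (q^ 3 · Z j) _ m ⟩
    (q^ a · q^ 3 · Z j) m xor (q^ a · q^ 1 + 4 * j · q^ 3 · Z j) m
      ≡⟨ cong₂ _xor_ (trans (q^·-q^· a 3 (Z j) m)
                       (trans (q^-exponent (Z j) (exponentA j s) m) (sym (q^·-q^· (3 + 4 * s) (j * (4 * s)) (Z j) m))))
                     (trans (q^·-cong a (q^·-q^· (1 + 4 * j) 3 (Z j)) m)
                       (trans (q^·-q^· a ((1 + 4 * j) + 3) (Z j) m)
                         (trans (q^-exponent (Z j) (exponentB j s) m) (sym (q^·-q^· (4 * suc s) (j * (4 * suc s)) (Z j) m))))) ⟩
    (A j ⊕ B j) m ∎
    where
    a = suc j * (4 * s)
    exponentA : ∀ j s → suc j * (4 * s) + 3 ≡ (3 + 4 * s) + j * (4 * s)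
    exponentA = solve-∀
    exponentB : ∀ j s → suc j * (4 * s) + ((1 + 4 * j) + 3) ≡ 4 * suc s + j * (4 * suc s)
    exponentB = solve-∀

-- The q-binomial theorem: (1 - q^(3+4s)) H_s = (1 - q^(4+4s)) H_(s+1) for H_s = qBinomialGF ∞ s.
qBinomialGF-step : ∀ J N s → N ≤ J →
  ⟨1+q^ 3 + 4 * s ⟩ qBinomialGF (suc J) s ≈[ N ] ⟨1+q^ 4 * suc s ⟩ qBinomialGF (suc J) (suc s)
qBinomialGF-step J N s N≤J = ⊕-swap {qBinomialGF (suc J) s}
  (≈-trans (≗⇒≈ N (qBinomialGF-telescope J s))
           (⊕-cong≈ (q^·-cong≈ (3 + 4 * s) (≈-sym (⨁-drop-last J _ (last≈𝟘 s))))
                    (q^·-cong≈ (4 * suc s) (≈-sym (⨁-drop-last J _ (last≈𝟘 (suc s)))))))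
  where
  last≈𝟘 : ∀ s′ → q^ J * (4 * s′) · qBinomialTerm J ≈[ N ] 𝟘
  last≈𝟘 s′ = ≈-mono N≤J (q^·-preserves-≈𝟘 (J * (4 * s′)) (qBinomialTerm≈𝟘 J))

qBinomialGF-∏ : ∀ J N M → N ≤ J →
  ∏⟨1+q^ progression 3 M ⟩ qBinomialGF (suc J) 0 ≈[ N ] ∏⟨1+q^ multiples 4 M ⟩ qBinomialGF (suc J) M
qBinomialGF-∏ J N zero N≤J m _ = refl
qBinomialGF-∏ J N (suc M) N≤J =
  ≈-trans (1+q^-cong≈ (3 + 4 * M) (qBinomialGF-∏ J N M N≤J))
  (≈-trans (≗⇒≈ N (λ m → sym (∏-1+q^ (multiples 4 M) (3 + 4 * M) (qBinomialGF (suc J) M) m)))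
  (≈-trans (∏-cong≈ (multiples 4 M) (qBinomialGF-step J N M N≤J))
           (≗⇒≈ N (∏-1+q^ (multiples 4 M) (4 * suc M) (qBinomialGF (suc J) (suc M))))))

qBinomialGF≈𝟙 : ∀ J N M → N ≤ 4 * M → qBinomialGF (suc J) M ≈[ N ] 𝟙
qBinomialGF≈𝟙 J N M N≤4M m m<N = trans (⨁-suc J _ m)
  (trans (cong (𝟙 m xor_) (⨁-≈𝟘 J _ (λ j _ → q^·≈𝟘 (suc j * (4 * M)) _ (≤-trans N≤4M (m≤m+n (4 * M) (j * (4 * M))))) m m<N))
         (xor-identityʳ (𝟙 m)))

-- Truncation of Σ_j q^(3j) / (q⁴;q⁴)_j · Σ_l q^((1+4j)l) / (q⁴;q⁴)_l, the generating series of cp_{3,1,4}.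
copartitionGF : ℕ → ℕ → Series
copartitionGF J L = ⨁ J (λ j → partitionGF 3 j ⊛ eulerGF L j)

copartitionGF-factor : ∀ J L N → N ≤ L →
  copartitionGF J (suc L) ≈[ N ] qBinomialGF J 0 ⊛ eulerGF (suc L) 0
copartitionGF-factor J L N N≤L =
  ≈-trans (⨁-cong≈ J (λ j _ → ⊛-cong≈ {partitionGF 3 j} (λ _ _ → refl) (eulerGF-∏ L N j N≤L)))
          (≗⇒≈ N regroup)
  where
  B₀ = eulerGF (suc L) 0
  regroup : ⨁ J (λ j → partitionGF 3 j ⊛ (∏⟨1+q^ progression 1 j ⟩ B₀)) ≗ qBinomialGF J 0 ⊛ B₀
  regroup m = begin
    ⨁ J (λ j → partitionGF 3 j ⊛ (∏⟨1+q^ progression 1 j ⟩ B₀)) m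
      ≡⟨ ⨁-cong J (λ j _ m′ → trans (⊛-∏ (progression 1 j) (partitionGF 3 j) B₀ m′)
                                    (sym (∏-⊛ (progression 1 j) (partitionGF 3 j) B₀ m′))) m ⟩
    ⨁ J (λ j → qBinomialTerm j ⊛ B₀) m
      ≡⟨ ⨁-⊛ J qBinomialTerm B₀ m ⟨
    (⨁ J qBinomialTerm ⊛ B₀) m
      ≡⟨ ⊛-congˡ B₀ (⨁-cong J (λ j _ → q^-exponent (qBinomialTerm j) (sym (trans (cong (j *_) (*-zeroʳ 4)) (*-zeroʳ j))))) m ⟩
    (qBinomialGF J 0 ⊛ B₀) m ∎
    where open ≡-Reasoning

copartitionGF≈ : ∀ J L N M → N ≤ J → N ≤ L → N ≤ 4 * M → N ≤ suc (M + M) →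
  copartitionGF (suc J) (suc L) ≈[ N ] ∏⟨1+q^ oneTo (M + M) ⟩ ∏⟨1+q^ multiples 4 M ⟩ 𝟙
copartitionGF≈ J L N M N≤J N≤L N≤4M N≤1+2M =
  ≈-trans (≈-mono N≤1+2M (≈-sym (∏-oneTo-odds≈id (M + M) S)))
          (∏-cong≈ (oneTo (M + M)) cleared)
  where
  S = copartitionGF (suc J) (suc L)
  H₀ = qBinomialGF (suc J) 0
  B₀ = eulerGF (suc L) 0
  P₃ = ∏⟨1+q^ progression 3 M ⟩_
  cleared : ∏⟨1+q^ odds (M + M) ⟩ S ≈[ N ] ∏⟨1+q^ multiples 4 M ⟩ 𝟙
  cleared =
    ≈-trans (≗⇒≈ N (∏-odds-split M S))
    (≈-trans (∏-cong≈ (progression 1 M) (∏-cong≈ (progression 3 M) (copartitionGF-factor (suc J) L N N≤L)))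
    (≈-trans (≗⇒≈ N (λ m → trans (∏-cong (progression 1 M) (λ m′ → sym (∏-⊛ (progression 3 M) H₀ B₀ m′)) m)
                                 (sym (⊛-∏ (progression 1 M) (P₃ H₀) B₀ m))))
    (≈-trans (⊛-cong≈ (qBinomialGF-∏ J N M N≤J) (≈-sym (eulerGF-∏ L N M N≤L)))
    (≈-trans (⊛-cong≈ (∏-cong≈ (multiples 4 M) (qBinomialGF≈𝟙 J N M N≤4M)) (eulerGF≈𝟙 L N M N≤4M))
             (≗⇒≈ N (⊛-𝟙 (∏⟨1+q^ multiples 4 M ⟩ 𝟙)))))))

≡ᵇ-cong : ∀ {a b a′ b′} → (a ≡ b → a′ ≡ b′) → (a′ ≡ b′ → a ≡ b) → (a ≡ᵇ b) ≡ (a′ ≡ᵇ b′)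
≡ᵇ-cong {a} {b} {a′} {b′} to from with a ≟ b
... | yes a≡b = trans (dec-true (a ≟ b) a≡b) (sym (dec-true (a′ ≟ b′) (to a≡b)))
... | no a≢b = trans (dec-false (a ≟ b) a≢b) (sym (dec-false (a′ ≟ b′) (λ a′≡b′ → a≢b (from a′≡b′))))

xorUpTo-select-sum : ∀ i n c (G : ℕ → Bool) → i ≤ n → xorUpTo (suc n) (λ l → G l ∧ (i + c + l ≡ᵇ n)) ≡ (q^ c · G) (n ∸ i)
xorUpTo-select-sum i n c G i≤n with i + c ≤? n
... | yes i+c≤n = begin
  xorUpTo (suc n) (λ l → G l ∧ (i + c + l ≡ᵇ n))
    ≡⟨ xorUpTo-cong (suc n) (λ l _ → trans (cong (G l ∧_) (≡ᵇ-cong to from)) (∧-comm (G l) _)) ⟩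
  xorUpTo (suc n) (λ l → (n ∸ (i + c) ≡ᵇ l) ∧ G l)
    ≡⟨ xorUpTo-select (suc n) (n ∸ (i + c)) G (s≤s (m∸n≤m n (i + c))) ⟩
  G (n ∸ (i + c))
    ≡⟨ cong G (∸-+-assoc n i c) ⟨
  G (n ∸ i ∸ c)
    ≡⟨ q^·-above c G (n ∸ i) c≤n∸i ⟨
  (q^ c · G) (n ∸ i) ∎
  where
  open ≡-Reasoning
  to : ∀ {l} → i + c + l ≡ n → n ∸ (i + c) ≡ l
  to {l} eq = trans (cong (_∸ (i + c)) (sym eq)) (m+n∸m≡n (i + c) l)
  from : ∀ {l} → n ∸ (i + c) ≡ l → i + c + l ≡ n
  from eq = trans (cong ((i + c) +_) (sym eq)) (m+[n∸m]≡n i+c≤n)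
  c≤n∸i : c ≤ n ∸ i
  c≤n∸i = subst (_≤ n ∸ i) (m+n∸m≡n i c) (∸-monoˡ-≤ i i+c≤n)
... | no i+c≰n =
  trans (xorUpTo-false (suc n) _ (λ l _ → trans (cong (G l ∧_) (dec-false (i + c + l ≟ n) (λ eq → i+c≰n (subst (i + c ≤_) eq (m≤m+n (i + c) l)))))
                                                (∧-zeroʳ (G l))))
        (sym (q^·-below c G (n ∸ i) n∸i<c))
  where
  n∸i<c : n ∸ i < c
  n∸i<c = +-cancelˡ-< i (n ∸ i) c (subst (_< i + c) (sym (m+[n∸m]≡n i≤n)) (≰⇒> i+c≰n))

xorOver-by-length : {A : Set} (xs : List A) (a : A → Bool) (len : A → ℕ) (Φ : ℕ → Bool) (J : ℕ) → All (λ x → len x < J) xs →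
  xorOver xs (λ x → a x ∧ Φ (len x)) ≡ xorUpTo J (λ j → xorOver xs (λ x → a x ∧ (len x ≡ᵇ j)) ∧ Φ j)
xorOver-by-length xs a len Φ J len<J = sym (begin
  xorUpTo J (λ j → xorOver xs (λ x → a x ∧ (len x ≡ᵇ j)) ∧ Φ j)
    ≡⟨ xorUpTo-cong J (λ j _ → trans (∧-comm _ (Φ j)) (trans (xorOver-∧ xs (Φ j) _) (xorOver-cong xs (λ x → ∧-comm (Φ j) _)))) ⟩
  xorUpTo J (λ j → xorOver xs (λ x → (a x ∧ (len x ≡ᵇ j)) ∧ Φ j))
    ≡⟨ xorOver-xorUpTo xs J (λ x j → (a x ∧ (len x ≡ᵇ j)) ∧ Φ j) ⟨
  xorOver xs (λ x → xorUpTo J (λ j → (a x ∧ (len x ≡ᵇ j)) ∧ Φ j))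
    ≡⟨ xorOver-cong-All xs (All.map (λ {x} lenx<J → select x lenx<J) len<J) ⟩
  xorOver xs (λ x → a x ∧ Φ (len x)) ∎)
  where
  open ≡-Reasoning
  select : ∀ x → len x < J → xorUpTo J (λ j → (a x ∧ (len x ≡ᵇ j)) ∧ Φ j) ≡ a x ∧ Φ (len x)
  select x lenx<J = trans (xorUpTo-cong J (λ j _ → ∧-assoc (a x) (len x ≡ᵇ j) (Φ j)))
                          (trans (sym (xorUpTo-∧ J (a x) _)) (cong (a x ∧_) (xorUpTo-select J (len x) Φ lenx<J)))

partitions-length< : ∀ i J → i < J → All (λ γ → length γ < J) (partitions i)
partitions-length< i J i<J = All.map (λ size-length → ≤-<-trans (proj₂ size-length) i<J) (boundedPartitions-size-length i i i)

partitions-size : ∀ i → All (λ γ → sum γ ≡ i) (partitions i)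
partitions-size i = All.map proj₁ (boundedPartitions-size-length i i i)

sum-replicate : ∀ a x → sum (replicate a x) ≡ a * x
sum-replicate zero x = refl
sum-replicate (suc a) x = cong (x +_) (sum-replicate a x)

isCopartition-candidate : ∀ n i l γ σ → sum γ ≡ i → sum σ ≡ l →
  does (isCopartition? 3 1 4 (γ , replicate (length σ) (4 * length γ) , σ) ×-dec (size (γ , replicate (length σ) (4 * length γ) , σ) ≟ n))
  ≡ allAdmissible 3 γ ∧ (allAdmissible 1 σ ∧ (i + length σ * (4 * length γ) + l ≡ᵇ n))
isCopartition-candidate n i l γ σ size-γ size-σ = begin
  (allAdmissible 3 γ ∧ (allAdmissible 1 σ ∧ (does (length ρ ≟ length σ) ∧ does (all? (_≟ 4 * length γ) ρ)))) ∧ (sum γ + sum ρ + sum σ ≡ᵇ n)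
    ≡⟨ cong₂ (λ x y → (allAdmissible 3 γ ∧ (allAdmissible 1 σ ∧ (x ∧ y))) ∧ (sum γ + sum ρ + sum σ ≡ᵇ n))
             (dec-true (length ρ ≟ length σ) (length-replicate (length σ)))
             (dec-true (all? (_≟ 4 * length γ) ρ) (replicate⁺ (length σ) refl)) ⟩
  (allAdmissible 3 γ ∧ (allAdmissible 1 σ ∧ true)) ∧ (sum γ + sum ρ + sum σ ≡ᵇ n)
    ≡⟨ cong (λ x → (allAdmissible 3 γ ∧ x) ∧ (sum γ + sum ρ + sum σ ≡ᵇ n)) (∧-identityʳ (allAdmissible 1 σ)) ⟩
  (allAdmissible 3 γ ∧ allAdmissible 1 σ) ∧ (sum γ + sum ρ + sum σ ≡ᵇ n)
    ≡⟨ ∧-assoc (allAdmissible 3 γ) (allAdmissible 1 σ) _ ⟩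
  allAdmissible 3 γ ∧ (allAdmissible 1 σ ∧ (sum γ + sum ρ + sum σ ≡ᵇ n))
    ≡⟨ cong (λ x → allAdmissible 3 γ ∧ (allAdmissible 1 σ ∧ (x ≡ᵇ n)))
            (cong₂ _+_ (cong₂ _+_ size-γ (sum-replicate (length σ) (4 * length γ))) size-σ) ⟩
  allAdmissible 3 γ ∧ (allAdmissible 1 σ ∧ (i + length σ * (4 * length γ) + l ≡ᵇ n)) ∎
  where
  open ≡-Reasoning
  ρ = replicate (length σ) (4 * length γ)

IsCopartitionOfSize? : (n : ℕ) (t : Partition × Partition × Partition) → Dec (IsCopartition 3 1 4 t × (size t ≡ n))
IsCopartitionOfSize? n t = isCopartition? 3 1 4 t ×-dec (size t ≟ n)

candidate : Partition → Partition → Partition × Partition × Partition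
candidate γ σ = (γ , replicate (length σ) (4 * length γ) , σ)

xorOver-candidates : ∀ n (F : Partition × Partition × Partition → Bool) → xorOver (candidates 4 n) F ≡
  xorUpTo (suc n) (λ i → xorUpTo (suc n) (λ l → xorOver (partitions i) (λ γ → xorOver (partitions l) (λ σ → F (candidate γ σ)))))
xorOver-candidates n F =
  trans (xorOver-concatMap (λ i → concatMap (byγ i) (upTo (suc n))) (upTo (suc n)) F)
  (trans (xorOver-upTo (suc n) _)
  (xorUpTo-cong (suc n) (λ i _ →
    trans (xorOver-concatMap (byγ i) (upTo (suc n)) F)
    (trans (xorOver-upTo (suc n) _)
    (xorUpTo-cong (suc n) (λ l _ →
      trans (xorOver-concatMap (λ γ → map (candidate γ) (partitions l)) (partitions i) F)
            (xorOver-cong (partitions i) (λ γ → xorOver-map (candidate γ) (partitions l) F))))))))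
  where
  byγ : ℕ → ℕ → List (Partition × Partition × Partition)
  byγ i l = concatMap (λ γ → map (candidate γ) (partitions l)) (partitions i)

xorOver-partition-pairs : ∀ n i l J L → i < J → l < L →
  xorOver (partitions i) (λ γ → xorOver (partitions l) (λ σ → does (IsCopartitionOfSize? n (candidate γ σ))))
  ≡ xorUpTo J (λ j → partitionGF 3 j i ∧ xorUpTo L (λ k → partitionGF 1 k l ∧ (i + k * (4 * j) + l ≡ᵇ n)))
xorOver-partition-pairs n i l J L i<J l<L = begin
  xorOver (partitions i) (λ γ → xorOver (partitions l) (λ σ → does (IsCopartitionOfSize? n (candidate γ σ))))
    ≡⟨ xorOver-cong-All (partitions i) (All.map (λ {γ} size-γ →
         trans (xorOver-cong-All (partitions l) (All.map (λ {σ} size-σ → isCopartition-candidate n i l γ σ size-γ size-σ) (partitions-size l)))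
               (sym (xorOver-∧ (partitions l) (allAdmissible 3 γ) (λ σ → allAdmissible 1 σ ∧ total (length γ) (length σ)))))
         (partitions-size i)) ⟩
  xorOver (partitions i) (λ γ → allAdmissible 3 γ ∧ Φ (length γ))
    ≡⟨ xorOver-by-length (partitions i) (allAdmissible 3) length Φ J (partitions-length< i J i<J) ⟩
  xorUpTo J (λ j → xorOver (partitions i) (λ γ → allAdmissible 3 γ ∧ (length γ ≡ᵇ j)) ∧ Φ j)
    ≡⟨ xorUpTo-cong J (λ j _ → cong₂ _∧_ (partitionGF-counts 3 j i)
         (trans (xorOver-by-length (partitions l) (allAdmissible 1) length (total j) L (partitions-length< l L l<L))
                (xorUpTo-cong L (λ k _ → cong (_∧ total j k) (partitionGF-counts 1 k l))))) ⟩
  xorUpTo J (λ j → partitionGF 3 j i ∧ xorUpTo L (λ k → partitionGF 1 k l ∧ (i + k * (4 * j) + l ≡ᵇ n))) ∎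
  where
  open ≡-Reasoning
  total : ℕ → ℕ → Bool
  total j k = i + k * (4 * j) + l ≡ᵇ n
  Φ : ℕ → Bool
  Φ j = xorOver (partitions l) (λ σ → allAdmissible 1 σ ∧ total j (length σ))

parity-cp : ∀ n J L → suc n ≤ J → suc n ≤ L → parity (cp 3 1 4 n) ≡ copartitionGF J L n
parity-cp n J L n<J n<L = begin
  parity (cp 3 1 4 n)
    ≡⟨ parity-filter (IsCopartitionOfSize? n) (candidates 4 n) ⟩
  xorOver (candidates 4 n) (λ t → does (IsCopartitionOfSize? n t))
    ≡⟨ xorOver-candidates n (λ t → does (IsCopartitionOfSize? n t)) ⟩
  xorUpTo (suc n) (λ i → xorUpTo (suc n) (λ l → xorOver (partitions i) (λ γ → xorOver (partitions l) (λ σ → does (IsCopartitionOfSize? n (candidate γ σ))))))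
    ≡⟨ xorUpTo-cong (suc n) (λ i i<1+n → xorUpTo-cong (suc n) (λ l l<1+n →
         xorOver-partition-pairs n i l J L (<-≤-trans i<1+n n<J) (<-≤-trans l<1+n n<L))) ⟩
  xorUpTo (suc n) (λ i → xorUpTo (suc n) (λ l → xorUpTo J (λ j → partitionGF 3 j i ∧ xorUpTo L (λ k → partitionGF 1 k l ∧ (i + k * (4 * j) + l ≡ᵇ n)))))
    ≡⟨ xorUpTo-cong (suc n) (λ i i<1+n → trans (xorUpTo-comm (suc n) J _) (xorUpTo-cong J (λ j _ → collect i j (≤-pred i<1+n)))) ⟩
  xorUpTo (suc n) (λ i → xorUpTo J (λ j → partitionGF 3 j i ∧ eulerGF L j (n ∸ i)))
    ≡⟨ xorUpTo-comm (suc n) J _ ⟩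
  xorUpTo J (λ j → xorUpTo (suc n) (λ i → partitionGF 3 j i ∧ eulerGF L j (n ∸ i)))
    ≡⟨ xorUpTo-cong J (λ j _ → sym (⊛-at (partitionGF 3 j) (eulerGF L j) n)) ⟩
  xorUpTo J (λ j → (partitionGF 3 j ⊛ eulerGF L j) n)
    ≡⟨ ⨁-at J (λ j → partitionGF 3 j ⊛ eulerGF L j) n ⟨
  copartitionGF J L n ∎
  where
  open ≡-Reasoning
  collect : ∀ i j → i ≤ n →
    xorUpTo (suc n) (λ l → partitionGF 3 j i ∧ xorUpTo L (λ k → partitionGF 1 k l ∧ (i + k * (4 * j) + l ≡ᵇ n)))
    ≡ partitionGF 3 j i ∧ eulerGF L j (n ∸ i)
  collect i j i≤n = begin
    xorUpTo (suc n) (λ l → partitionGF 3 j i ∧ xorUpTo L (λ k → partitionGF 1 k l ∧ (i + k * (4 * j) + l ≡ᵇ n)))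
      ≡⟨ xorUpTo-∧ (suc n) (partitionGF 3 j i) _ ⟨
    partitionGF 3 j i ∧ xorUpTo (suc n) (λ l → xorUpTo L (λ k → partitionGF 1 k l ∧ (i + k * (4 * j) + l ≡ᵇ n)))
      ≡⟨ cong (partitionGF 3 j i ∧_) (xorUpTo-comm (suc n) L _) ⟩
    partitionGF 3 j i ∧ xorUpTo L (λ k → xorUpTo (suc n) (λ l → partitionGF 1 k l ∧ (i + k * (4 * j) + l ≡ᵇ n)))
      ≡⟨ cong (partitionGF 3 j i ∧_) (xorUpTo-cong L (λ k _ → xorUpTo-select-sum i n (k * (4 * j)) (partitionGF 1 k) i≤n)) ⟩
    partitionGF 3 j i ∧ xorUpTo L (λ k → (q^ k * (4 * j) · partitionGF 1 k) (n ∸ i))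
      ≡⟨ cong (partitionGF 3 j i ∧_) (⨁-at L (λ k → q^ k * (4 * j) · partitionGF 1 k) (n ∸ i)) ⟨
    partitionGF 3 j i ∧ eulerGF L j (n ∸ i) ∎

data Pentagonal : ℕ → Set where
  pentagonal-0 : Pentagonal 0
  pentagonal⁺ : ∀ j → Pentagonal (ω⁺ j)
  pentagonal⁻ : ∀ j → Pentagonal (ω⁻ j)

2*triangular : ∀ j → 2 * triangular j ≡ j * suc j
2*triangular zero = refl
2*triangular (suc j) = begin
  2 * (triangular j + suc j)     ≡⟨ *-distribˡ-+ 2 (triangular j) (suc j) ⟩
  2 * triangular j + 2 * suc j   ≡⟨ cong (_+ 2 * suc j) (2*triangular j) ⟩
  j * suc j + 2 * suc j          ≡⟨ factor j ⟩
  suc j * suc (suc j)            ∎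
  where
  open ≡-Reasoning
  factor : ∀ j → j * suc j + 2 * suc j ≡ suc j * suc (suc j)
  factor = solve-∀

-- ω(k) = k(3k-1)/2 satisfies 24 ω(k) + 1 = (6k - 1)².
pentagonal-square : ∀ {e} → Pentagonal e → ∃ λ x → 24 * e + 1 ≡ x * x
pentagonal-square pentagonal-0 = 1 , refl
pentagonal-square (pentagonal⁺ j) = 6 * j + 5 , (begin
  24 * (suc (j + j) + (j * j + triangular j)) + 1  ≡⟨ regroup j (triangular j) ⟩
  24 * (suc (j + j) + j * j) + 12 * (2 * triangular j) + 1
                                                   ≡⟨ cong (λ x → 24 * (suc (j + j) + j * j) + 12 * x + 1) (2*triangular j) ⟩
  24 * (suc (j + j) + j * j) + 12 * (j * suc j) + 1 ≡⟨ square j ⟩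
  (6 * j + 5) * (6 * j + 5)                        ∎)
  where
  open ≡-Reasoning
  regroup : ∀ j t → 24 * (suc (j + j) + (j * j + t)) + 1 ≡ 24 * (suc (j + j) + j * j) + 12 * (2 * t) + 1
  regroup = solve-∀
  square : ∀ j → 24 * (suc (j + j) + j * j) + 12 * (j * suc j) + 1 ≡ (6 * j + 5) * (6 * j + 5)
  square = solve-∀
pentagonal-square (pentagonal⁻ j) = 6 * suc j + 1 , (begin
  24 * (J * J + triangular J) + 1        ≡⟨ regroup J (triangular J) ⟩
  24 * (J * J) + 12 * (2 * triangular J) + 1 ≡⟨ cong (λ x → 24 * (J * J) + 12 * x + 1) (2*triangular J) ⟩
  24 * (J * J) + 12 * (J * suc J) + 1    ≡⟨ square J ⟩
  (6 * J + 1) * (6 * J + 1)              ∎)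
  where
  open ≡-Reasoning
  J = suc j
  regroup : ∀ m t → 24 * (m * m + t) + 1 ≡ 24 * (m * m) + 12 * (2 * t) + 1
  regroup = solve-∀
  square : ∀ m → 24 * (m * m) + 12 * (m * suc m) + 1 ≡ (6 * m + 1) * (6 * m + 1)
  square = solve-∀

pentagonalSum-vanishes : ∀ t K f x → (∀ {e} → Pentagonal e → t * e ≤ x → f (x ∸ t * e) ≡ false) → pentagonalSum t K f x ≡ false
pentagonalSum-vanishes t K f x f-vanishes =
  cong₂ _xor_ constant-term
              (trans (⨁-at K _ x) (xorUpTo-false K _ (λ j _ → cong₂ _xor_ (shifted (pentagonal⁺ j)) (shifted (pentagonal⁻ j)))))
  where
  constant-term : f x ≡ false
  constant-term = trans (cong (λ e → f (x ∸ e)) (sym (*-zeroʳ t))) (f-vanishes pentagonal-0 (subst (_≤ x) (sym (*-zeroʳ t)) z≤n))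
  shifted : ∀ {e} → Pentagonal e → (q^ t * e · f) x ≡ false
  shifted {e} pe with t * e ≤? x
  ... | yes te≤x = trans (q^·-above (t * e) f x te≤x) (f-vanishes pe te≤x)
  ... | no te≰x = q^·-below (t * e) f x (≰⇒> te≰x)

sum-of-squares-mod-11 : ∀ (X Y : Fin 11) → (toℕ X * toℕ X + 4 * (toℕ Y * toℕ Y)) % 11 ≡ 0 → toℕ X ≡ 0 × toℕ Y ≡ 0
sum-of-squares-mod-11 = from-yes (Fin.all? {11} λ X → Fin.all? {11} λ Y →
  ((toℕ X * toℕ X + 4 * (toℕ Y * toℕ Y)) % 11 ≟ 0) →-dec ((toℕ X ≟ 0) ×-dec (toℕ Y ≟ 0)))

sum-of-squares-%11 : ∀ x y → (x * x + 4 * (y * y)) % 11 ≡ ((x % 11) * (x % 11) + 4 * ((y % 11) * (y % 11))) % 11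
sum-of-squares-%11 x y = begin
  (x * x + 4 * (y * y)) % 11                 ≡⟨ %-distribˡ-+ (x * x) (4 * (y * y)) 11 ⟩
  ((x * x) % 11 + (4 * (y * y)) % 11) % 11    ≡⟨ cong₂ (λ a b → (a + b) % 11) (%-distribˡ-* x x 11) 4y²-reduced ⟩
  ((X * X) % 11 + (4 * (Y * Y)) % 11) % 11    ≡⟨ %-distribˡ-+ (X * X) (4 * (Y * Y)) 11 ⟨
  (X * X + 4 * (Y * Y)) % 11                 ∎
  where
  open ≡-Reasoning
  X = x % 11
  Y = y % 11
  4y²-reduced : (4 * (y * y)) % 11 ≡ (4 * (Y * Y)) % 11
  4y²-reduced = begin
    (4 * (y * y)) % 11               ≡⟨ %-distribˡ-* 4 (y * y) 11 ⟩
    (4 % 11 * ((y * y) % 11)) % 11   ≡⟨ cong (λ a → (4 % 11 * a) % 11) (%-distribˡ-* y y 11) ⟩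
    (4 % 11 * ((Y * Y) % 11)) % 11   ≡⟨ %-distribˡ-* 4 (Y * Y) 11 ⟨
    (4 * (Y * Y)) % 11               ∎

11∣sum-of-squares⇒121∣ : ∀ x y → 11 ∣ x * x + 4 * (y * y) → 121 ∣ x * x + 4 * (y * y)
11∣sum-of-squares⇒121∣ x y 11∣ = ∣m∣n⇒∣m+n (*-pres-∣ 11∣x 11∣x) (∣-trans (*-pres-∣ 11∣y 11∣y) (n∣m*n 4))
  where
  X = fromℕ< (m%n<n x 11)
  Y = fromℕ< (m%n<n y 11)
  residues-vanish : toℕ X ≡ 0 × toℕ Y ≡ 0
  residues-vanish = sum-of-squares-mod-11 X Y
    (trans (cong₂ (λ a b → (a * a + 4 * (b * b)) % 11) (toℕ-fromℕ< (m%n<n x 11)) (toℕ-fromℕ< (m%n<n y 11)))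
           (trans (sym (sum-of-squares-%11 x y)) (n∣m⇒m%n≡0 _ 11 11∣)))
  11∣x : 11 ∣ x
  11∣x = m%n≡0⇒n∣m x 11 (trans (sym (toℕ-fromℕ< (m%n<n x 11))) (proj₁ residues-vanish))
  11∣y : 11 ∣ y
  11∣y = m%n≡0⇒n∣m y 11 (trans (sym (toℕ-fromℕ< (m%n<n y 11))) (proj₂ residues-vanish))

no-pentagonal-representation : ∀ k r {e₁ e₂} → 11 ∣ 24 * r + 5 → 121 ∤ 24 * r + 5 →
  Pentagonal e₁ → Pentagonal e₂ → 121 * k + r ≢ e₁ + 4 * e₂
no-pentagonal-representation k r {e₁} {e₂} 11∣ 121∤ pe₁ pe₂ n≡ with pentagonal-square pe₁ | pentagonal-square pe₂
... | x , x² | y , y² = 121∤ (∣m+n∣m⇒∣n (subst (121 ∣_) sum≡ 121∣sum) (n∣m*n (24 * k)))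
  where
  sum≡ : x * x + 4 * (y * y) ≡ 24 * k * 121 + (24 * r + 5)
  sum≡ = begin
    x * x + 4 * (y * y)                   ≡⟨ cong₂ (λ a b → a + 4 * b) x² y² ⟨
    (24 * e₁ + 1) + 4 * (24 * e₂ + 1)     ≡⟨ regroup e₁ e₂ ⟩
    24 * (e₁ + 4 * e₂) + 5                ≡⟨ cong (λ n → 24 * n + 5) n≡ ⟨
    24 * (121 * k + r) + 5                ≡⟨ expand k r ⟩
    24 * k * 121 + (24 * r + 5)           ∎
    where
    open ≡-Reasoning
    regroup : ∀ a b → (24 * a + 1) + 4 * (24 * b + 1) ≡ 24 * (a + 4 * b) + 5
    regroup = solve-∀
    expand : ∀ k r → 24 * (121 * k + r) + 5 ≡ 24 * k * 121 + (24 * r + 5)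
    expand = solve-∀
  121∣sum : 121 ∣ x * x + 4 * (y * y)
  121∣sum = 11∣sum-of-squares⇒121∣ x y (subst (11 ∣_) (sym sum≡) (∣m∣n⇒∣m+n (∣-trans (divides 11 refl) (n∣m*n (24 * k))) 11∣))

parity≡false⇒2∣ : ∀ m → parity m ≡ false → 2 ∣ m
parity≡false⇒2∣ zero _ = divides 0 refl
parity≡false⇒2∣ (suc (suc m)) even with parity≡false⇒2∣ m (trans (sym (not-involutive (parity m))) even)
... | divides q m≡q*2 = divides (suc q) (cong (λ x → suc (suc x)) m≡q*2)

𝟙-positive : ∀ z → z ≢ 0 → 𝟙 z ≡ false
𝟙-positive zero z≢0 = contradiction refl z≢0
𝟙-positive (suc z) _ = refl

parity-cp≡pentagonalSum : ∀ n → parity (cp 3 1 4 n) ≡ pentagonalSum 1 (suc n + suc n) (pentagonalSum 4 (suc n) 𝟙) n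
parity-cp≡pentagonalSum n = begin
  parity (cp 3 1 4 n)                                      ≡⟨ parity-cp n (suc M) (suc M) (n≤1+n M) (n≤1+n M) ⟩
  copartitionGF (suc M) (suc M) n                          ≡⟨ copartitionGF≈ M M M M ≤-refl ≤-refl M≤4M M≤1+2M n ≤-refl ⟩
  (∏⟨1+q^ oneTo (M + M) ⟩ ∏⟨1+q^ multiples 4 M ⟩ 𝟙) n       ≡⟨ cong (λ es → (∏⟨1+q^ es ⟩ ∏⟨1+q^ multiples 4 M ⟩ 𝟙) n) (multiples-1 (M + M)) ⟨
  (∏⟨1+q^ multiples 1 (M + M) ⟩ ∏⟨1+q^ multiples 4 M ⟩ 𝟙) n ≡⟨ ∏-cong≈ (multiples 1 (M + M)) (≈-mono M≤4[1+M] (∏-multiples≈pentagonalSum 4 M 𝟙)) n ≤-refl ⟩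
  (∏⟨1+q^ multiples 1 (M + M) ⟩ pentagonalSum 4 M 𝟙) n     ≡⟨ ∏-multiples≈pentagonalSum 1 (M + M) (pentagonalSum 4 M 𝟙) n n<1+2M ⟩
  pentagonalSum 1 (M + M) (pentagonalSum 4 M 𝟙) n          ∎
  where
  open ≡-Reasoning
  M = suc n
  M≤4M : M ≤ 4 * M
  M≤4M = m≤m+n M (3 * M)
  M≤1+2M : M ≤ suc (M + M)
  M≤1+2M = ≤-trans (m≤m+n M M) (n≤1+n (M + M))
  M≤4[1+M] : M ≤ 4 * suc M
  M≤4[1+M] = ≤-trans (n≤1+n M) (m≤m+n (suc M) (3 * suc M))
  n<1+2M : n < 1 * suc (M + M)
  n<1+2M = subst (n <_) (sym (*-identityˡ (suc (M + M)))) M≤1+2M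

cp-even : ∀ k r → 11 ∣ 24 * r + 5 → 121 ∤ 24 * r + 5 → parity (cp 3 1 4 (121 * k + r)) ≡ false
cp-even k r 11∣ 121∤ =
  trans (parity-cp≡pentagonalSum n)
        (pentagonalSum-vanishes 1 (suc n + suc n) (pentagonalSum 4 (suc n) 𝟙) n (λ {e₁} pe₁ e₁≤n →
          pentagonalSum-vanishes 4 (suc n) 𝟙 (n ∸ 1 * e₁) (λ {e₂} pe₂ 4e₂≤ →
            𝟙-positive (n ∸ 1 * e₁ ∸ 4 * e₂) (λ rest≡0 →
              no-pentagonal-representation k r 11∣ 121∤ pe₁ pe₂ (decomposition {e₁} {e₂} e₁≤n 4e₂≤ rest≡0)))))
  where
  n = 121 * k + r
  decomposition : ∀ {e₁ e₂} → 1 * e₁ ≤ n → 4 * e₂ ≤ n ∸ 1 * e₁ → n ∸ 1 * e₁ ∸ 4 * e₂ ≡ 0 → n ≡ e₁ + 4 * e₂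
  decomposition {e₁} e₁≤n 4e₂≤ rest≡0 =
    trans (sym (m+[n∸m]≡n e₁≤n)) (cong₂ _+_ (*-identityˡ e₁) (≤-antisym (m∸n≡0⇒m≤n rest≡0) 4e₂≤))

residues-11∥24r+5 : All (λ r → 11 ∣ 24 * r + 5 × 121 ∤ 24 * r + 5) (3 ∷ 14 ∷ 36 ∷ 47 ∷ 58 ∷ 69 ∷ 80 ∷ 91 ∷ 102 ∷ 113 ∷ [])
residues-11∥24r+5 = from-yes (all? (λ r → (11 ∣? 24 * r + 5) ×-dec ¬? (121 ∣? 24 * r + 5)) (3 ∷ 14 ∷ 36 ∷ 47 ∷ 58 ∷ 69 ∷ 80 ∷ 91 ∷ 102 ∷ 113 ∷ []))

corollary4p9 : (r : ℕ) → r ∈ (3 ∷ 14 ∷ 36 ∷ 47 ∷ 58 ∷ 69 ∷ 80 ∷ 91 ∷ 102 ∷ 113 ∷ []) →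
    (k : ℕ) → 2 ∣ cp 3 1 4 (121 * k + r)
corollary4p9 r r∈residues k = parity≡false⇒2∣ _ (cp-even k r (proj₁ conditions) (proj₂ conditions))
  where
  conditions : 11 ∣ 24 * r + 5 × 121 ∤ 24 * r + 5
  conditions = All.lookup residues-11∥24r+5 r∈residues
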